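{- Let $n\ge 1$ and let $\mathcal{Q}_n$ be the set of PC prographs of size $n$ having no edge going from the output of a product to the input of a coproduct. Order $\mathcal{Q}_n$ by $P\le Q$ if and only if $Q$ is obtained from $P$ by a finite (possibly empty) sequence of applications of the coproduct rotation and the product rotation. Then $(\mathcal{Q}_n,\le)$ is a lattice, isomorphic to the product lattice $\mathcal{T}_n\times\mathcal{T}_n$, where $\mathcal{T}_n$ is the Tamari lattice on binary trees with $n$ nodes.
   Context: A PC prograph of size $n$ is a connected, directed, acyclic graph embedded in the plane with all edges drawn going upward, considered up to isotopy. It has $n$ coproducts and $n$ products: - a coproduct has one input (from below) and two outputs (upward), called left and right according to the planar embedding; - a product has two inputs, left and right according to the embedding, and one output. Every input is connected by an edge to exactly one output, with two exceptions: exactly one coproduct has its input unconnected (the global input, at the bottom), and exactly one product has its output unconnected (the global output, at the top). The embedding is planar. Coproduct rotation: take a coproduct $c_1$ whose right output feeds the input of a coproduct $c_2$. Let $x$ be the edge leaving the left output of $c_1$, and $y,z$ the edges leaving the left and right outputs of $c_2$. Replace this configuration by one in which the left output of $c_1$ feeds $c_2$, the outputs of $c_2$ are $x,y$ (left to right), and the right output of $c_1$ is $z$. The input edge of $c_1$ is unchanged. Product rotation: take a product $p_1$ whose left input receives the output of a product $p_2$. Let $x,y$ be the left and right inputs of $p_2$, and $z$ the right input of $p_1$. Replace this configuration by one in which the output of $p_2$ feeds the right input of $p_1$, the left input of $p_1$ is $x$, and the inputs of $p_2$ are $y,z$. The output edge of $p_1$ is unchanged. In bracket notation, the product rotation is $(xy)z\to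 x(yz)$. -}

module Defs where

open import Data.Nat using (ℕ; zero; suc; pred; _<_; _≤_)
open import Data.Bool using (Bool; true; false)
open import Data.List using (List; []; _∷_; _++_)
open import Data.Product using (Σ; _×_; _,_; proj₁; proj₂; ∃₂)
open import Data.Sum using (_⊎_)
open import Data.Unit using (⊤)
open import Relation.Binary.PropositionalEquality using (_≡_)
open import Relation.Binary.Construct.Closure.ReflexiveTransitive using (Star)
open import Relation.Binary.Construct.Closure.Equivalence using (EqClosure)

-- PC prographs as layered (generic) planar string diagrams.
--
-- A diagram is read from bottom to top as a list of layers.  At each
-- height there is a row of parallel upward wires, numbered 0,1,2,...
-- from left to right.  A layer contains exactly one vertex:
--   (co , i) : a coproduct whose input is wire i; it is replaced by
--              its left output (new wire i) and right output (new wire i+1);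
--   (pr , i) : a product whose left/right inputs are wires i, i+1;
--              they are replaced by its output (new wire i).
-- The bottom boundary has one wire (the global input) and the top
-- boundary one wire (the global output).  By Joyal–Street, isotopy
-- classes of such upward planar diagrams are exactly the classes of
-- layered diagrams modulo interchange of vertices at consecutive
-- heights acting on disjoint wires (relation _⇄_ below).

data Gen : Set where
  co pr : Gen

Layer : Set
Layer = Gen × ℕ

Diagram : Set
Diagram = List Layer

Valid : ℕ → Diagram → Set
Valid w []             = w ≡ 1
Valid w ((co , i) ∷ l) = i < w × Valid (suc w) l
Valid w ((pr , i) ∷ l) = suc i < w × Valid (pred w) l

#co : Diagram → ℕ
#co []             = 0
#co ((co , _) ∷ l) = suc (#co l)
#co ((pr , _) ∷ l) = #co l

#pr : Diagram → ℕ
#pr []             = 0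
#pr ((co , _) ∷ l) = #pr l
#pr ((pr , _) ∷ l) = suc (#pr l)

-- Edges from the output of a product to the input of a coproduct.
-- We track, for each current wire, whether it is the output of a product.

lookupB : List Bool → ℕ → Bool
lookupB []       _       = false
lookupB (b ∷ bs) zero    = b
lookupB (b ∷ bs) (suc i) = lookupB bs i

splitCo : List Bool → ℕ → List Bool
splitCo []       _       = []
splitCo (b ∷ bs) zero    = false ∷ false ∷ bs
splitCo (b ∷ bs) (suc i) = b ∷ splitCo bs i

mergePr : List Bool → ℕ → List Bool
mergePr []           _       = []
mergePr (b ∷ [])     zero    = true ∷ []
mergePr (b ∷ c ∷ bs) zero    = true ∷ bs
mergePr (b ∷ bs)     (suc i) = b ∷ mergePr bs i

NoPC : List Bool → Diagram → Set
NoPC ws []             = ⊤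
NoPC ws ((co , i) ∷ l) = lookupB ws i ≡ false × NoPC (splitCo ws i) l
NoPC ws ((pr , i) ∷ l) = NoPC (mergePr ws i) l

data _⇄_ : Diagram → Diagram → Set where
  swap-co : ∀ pre post i k g → suc i ≤ k →
    (pre ++ (co , i) ∷ (g , suc k) ∷ post) ⇄ (pre ++ (g , k) ∷ (co , i) ∷ post)
  swap-pr : ∀ pre post i j g → suc i ≤ j →
    (pre ++ (pr , i) ∷ (g , j) ∷ post) ⇄ (pre ++ (g , suc j) ∷ (pr , i) ∷ post)

-- isotopy of diagrams (the symmetric closure covers the mirror cases)
_≅_ : Diagram → Diagram → Set
_≅_ = EqClosure _⇄_

data _⟶_ : Diagram → Diagram → Set where
  -- coproduct rotation: c1 at i, c2 on the right output of c1
  --   becomes c1 at i, c2 on the left output of c1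
  rot-co : ∀ pre post i →
    (pre ++ (co , i) ∷ (co , suc i) ∷ post) ⟶ (pre ++ (co , i) ∷ (co , i) ∷ post)
  -- product rotation (xy)z → x(yz)
  rot-pr : ∀ pre post i →
    (pre ++ (pr , i) ∷ (pr , i) ∷ post) ⟶ (pre ++ (pr , suc i) ∷ (pr , i) ∷ post)

IsQ : ℕ → Diagram → Set
IsQ n D = Valid 1 D × #co D ≡ n × #pr D ≡ n × NoPC (false ∷ []) D

Q : ℕ → Set
Q n = Σ Diagram (IsQ n)

_≈Q_ : ∀ {n} → Q n → Q n → Set
P ≈Q R = proj₁ P ≅ proj₁ R

RotQ : ∀ {n} → Q n → Q n → Set
RotQ P R = ∃₂ λ A B → (proj₁ P ≅ A) × (A ⟶ B) × (B ≅ proj₁ R)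

_≤Q_ : ∀ {n} → Q n → Q n → Set
_≤Q_ = Star (λ P R → (P ≈Q R) ⊎ RotQ P R)

data Tree : Set where
  leaf : Tree
  node : Tree → Tree → Tree

size : Tree → ℕ
size leaf       = 0
size (node s t) = suc (size s Data.Nat.+ size t)

data TStep : Tree → Tree → Set where
  rot   : ∀ x y z → TStep (node (node x y) z) (node x (node y z))
  congˡ : ∀ {s s'} t → TStep s s' → TStep (node s t) (node s' t)
  congʳ : ∀ s {t t'} → TStep t t' → TStep (node s t) (node s t')

T : ℕ → Set
T n = Σ Tree (λ t → size t ≡ n)

_≤T_ : ∀ {n} → T n → T n → Set
s ≤T t = Star TStep (proj₁ s) (proj₁ t)

_≤TT_ : ∀ {n} → T n × T n → T n × T n → Set
(s₁ , s₂) ≤TT (t₁ , t₂) = (s₁ ≤T t₁) × (s₂ ≤T t₂)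

module Submission where

-- A diagram is evaluated twice: bottom-up, where each product grafts the trees on its two
-- inputs, giving the product tree at the global output; and top-down, where each coproduct
-- grafts the trees on its two outputs, giving the coproduct tree at the global input. Both
-- are isotopy invariants, and each rotation is a Tamari rotation of one tree and leaves the
-- other fixed. When no product feeds a coproduct, every coproduct can be slid below every
-- product, so a diagram is isotopic to the canonical one stacking its product tree on top of
-- its coproduct tree; rotations of either tree lift to rotations of this canonical diagram.
-- Hence the pair of trees is an order isomorphism onto T n × T n. That T n is a lattice
-- follows from the Huang–Tamari description of the Tamari order as the pointwise order on
-- bracket vectors, which is closed under pointwise minima; joins come from mirroring.

open import Defs
open import Data.Nat using (ℕ; zero; suc; pred; _+_; _∸_; _⊓_; _≤_; _<_; z≤n; s≤s; _≤?_)
open import Data.Nat.Properties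
open import Data.Nat.Tactic.RingSolver using (solve-∀)
open import Data.Bool using (Bool; true; false)
open import Data.List using (List; []; _∷_; _++_; length; replicate; zipWith)
open import Data.List.Properties using (++-assoc; ++-identityʳ; length-++; length-replicate; length-zipWith; zipWith-comm)
open import Data.List.Relation.Binary.Pointwise as Pointwise using (Pointwise; []; _∷_; Pointwise-length)
open import Data.List.Relation.Unary.All using (All; []; _∷_)
open import Data.List.Relation.Unary.All.Properties using (++⁺)
open import Data.Product using (Σ; _×_; _,_; proj₁; proj₂; ∃; ∃₂)
open import Data.Sum using (_⊎_; inj₁; inj₂)
open import Data.Unit using (⊤; tt)
open import Data.Empty using (⊥-elim)
open import Function.Bundles using (_⇔_; mk⇔)
open import Relation.Nullary using (yes; no)
open import Relation.Binary.Definitions using (tri<; tri≈; tri>)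
open import Relation.Binary.Lattice.Structures using (IsLattice)
open import Relation.Binary.PropositionalEquality
open import Relation.Binary.Construct.Closure.ReflexiveTransitive using (Star; ε; _◅_; _◅◅_; gmap)
import Relation.Binary.Construct.Closure.Equivalence as EqClosure
import Relation.Binary.Reasoning.Setoid as SetoidReasoning

Pointwise-++⁻ : ∀ {A : Set} {R : A → A → Set} xs {ys xs' ys'} → length xs ≡ length xs' →
                Pointwise R (xs ++ ys) (xs' ++ ys') → Pointwise R xs xs' × Pointwise R ys ys'
Pointwise-++⁻ []       {xs' = []}    _ rs       = [] , rs
Pointwise-++⁻ (x ∷ xs) {xs' = _ ∷ _} e (r ∷ rs) =
  let (p , q) = Pointwise-++⁻ xs (suc-injective e) rs in r ∷ p , q

infix 4 _≤ᵥ_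
infixl 7 _⊓ᵥ_

_≤ᵥ_ : List ℕ → List ℕ → Set
_≤ᵥ_ = Pointwise _≤_

≤ᵥ-refl : ∀ {xs} → xs ≤ᵥ xs
≤ᵥ-refl = Pointwise.refl ≤-refl

≤ᵥ-trans : ∀ {xs ys zs} → xs ≤ᵥ ys → ys ≤ᵥ zs → xs ≤ᵥ zs
≤ᵥ-trans = Pointwise.transitive ≤-trans

_⊓ᵥ_ : List ℕ → List ℕ → List ℕ
_⊓ᵥ_ = zipWith _⊓_

⊓ᵥ-comm : ∀ xs ys → xs ⊓ᵥ ys ≡ ys ⊓ᵥ xs
⊓ᵥ-comm = zipWith-comm _⊓_ ⊓-comm

⊓ᵥ-++ : ∀ xs ys {us vs} → length xs ≡ length ys → (xs ++ us) ⊓ᵥ (ys ++ vs) ≡ xs ⊓ᵥ ys ++ us ⊓ᵥ vs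
⊓ᵥ-++ []       []       _ = refl
⊓ᵥ-++ (x ∷ xs) (y ∷ ys) e = cong (x ⊓ y ∷_) (⊓ᵥ-++ xs ys (suc-injective e))

length-⊓ᵥ : ∀ xs ys → length xs ≡ length ys → length (xs ⊓ᵥ ys) ≡ length xs
length-⊓ᵥ xs ys e = trans (length-zipWith _⊓_ xs ys) (trans (cong (length xs ⊓_) (sym e)) (⊓-idem _))

⊓ᵥ-≤ˡ : ∀ xs ys → length xs ≡ length ys → xs ⊓ᵥ ys ≤ᵥ xs
⊓ᵥ-≤ˡ []       []       _ = []
⊓ᵥ-≤ˡ (x ∷ xs) (y ∷ ys) e = m⊓n≤m x y ∷ ⊓ᵥ-≤ˡ xs ys (suc-injective e)

⊓ᵥ-≤ʳ : ∀ xs ys → length xs ≡ length ys → xs ⊓ᵥ ys ≤ᵥ ys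
⊓ᵥ-≤ʳ []       []       _ = []
⊓ᵥ-≤ʳ (x ∷ xs) (y ∷ ys) e = m⊓n≤n x y ∷ ⊓ᵥ-≤ʳ xs ys (suc-injective e)

⊓ᵥ-glb : ∀ {us xs ys} → us ≤ᵥ xs → us ≤ᵥ ys → us ≤ᵥ xs ⊓ᵥ ys
⊓ᵥ-glb []       []       = []
⊓ᵥ-glb (p ∷ ps) (q ∷ qs) = ⊓-glb p q ∷ ⊓ᵥ-glb ps qs

splitAtIndex : ∀ {A : Set} (xs : List A) k → k < length xs →
               Σ (List A) λ ys → Σ A λ a → Σ (List A) λ zs → (xs ≡ ys ++ a ∷ zs) × (length ys ≡ k)
splitAtIndex (x ∷ xs) zero    _         = [] , x , xs , refl , refl
splitAtIndex (x ∷ xs) (suc k) (s≤s k<n) =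
  let (ys , a , zs , e , l) = splitAtIndex xs k k<n in x ∷ ys , a , zs , cong (x ∷_) e , cong suc l

infix 4 _≤ₜ_
_≤ₜ_ : Tree → Tree → Set
_≤ₜ_ = Star TStep

size-rot : ∀ x y z → size (node (node x y) z) ≡ size (node x (node y z))
size-rot x y z = cong suc (lemma (size x) (size y) (size z))
  where
    lemma : ∀ a b c → suc (a + b) + c ≡ a + suc (b + c)
    lemma = solve-∀

TStep-size : ∀ {s t} → TStep s t → size s ≡ size t
TStep-size (rot x y z) = size-rot x y z
TStep-size (congˡ t p) = cong (λ k → suc (k + size t)) (TStep-size p)
TStep-size (congʳ s p) = cong (λ k → suc (size s + k)) (TStep-size p)

≤ₜ-reflexive : ∀ {s t} → s ≡ t → s ≤ₜ t
≤ₜ-reflexive refl = ε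

≤ₜ-congˡ : ∀ {s s'} t → s ≤ₜ s' → node s t ≤ₜ node s' t
≤ₜ-congˡ t = gmap (λ s → node s t) (congˡ t)

≤ₜ-congʳ : ∀ s {t t'} → t ≤ₜ t' → node s t ≤ₜ node s t'
≤ₜ-congʳ s = gmap (node s) (congʳ s)

≤ₜ-node : ∀ {a a' b b'} → a ≤ₜ a' → b ≤ₜ b' → node a b ≤ₜ node a' b'
≤ₜ-node {a' = a'} {b = b} p q = ≤ₜ-congˡ b p ◅◅ ≤ₜ-congʳ a' q

bracket : Tree → List ℕ
bracket leaf       = []
bracket (node a b) = bracket a ++ size b ∷ bracket b

length-bracket : ∀ t → length (bracket t) ≡ size t
length-bracket leaf       = refl
length-bracket (node a b) = begin
  length (bracket a ++ size b ∷ bracket b)   ≡⟨ length-++ (bracket a) ⟩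
  length (bracket a) + suc (length (bracket b)) ≡⟨ cong₂ (λ p q → p + suc q) (length-bracket a) (length-bracket b) ⟩
  size a + suc (size b)                      ≡⟨ +-suc (size a) (size b) ⟩
  size (node a b)                            ∎
  where open ≡-Reasoning

TStep-bracket : ∀ {s t} → TStep s t → bracket s ≤ᵥ bracket t
TStep-bracket (rot x y z) =
  subst (_≤ᵥ bracket (node x (node y z))) (sym (++-assoc (bracket x) (size y ∷ bracket y) (size z ∷ bracket z)))
    (Pointwise.++⁺ ≤ᵥ-refl (m≤n⇒m≤1+n (m≤m+n (size y) (size z)) ∷ ≤ᵥ-refl))
TStep-bracket (congˡ t p) = Pointwise.++⁺ (TStep-bracket p) ≤ᵥ-refl
TStep-bracket (congʳ s p) = Pointwise.++⁺ ≤ᵥ-refl (≤-reflexive (TStep-size p) ∷ TStep-bracket p)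

bracket-mono : ∀ {s t} → s ≤ₜ t → bracket s ≤ᵥ bracket t
bracket-mono ε        = ≤ᵥ-refl
bracket-mono (p ◅ ps) = ≤ᵥ-trans (TStep-bracket p) (bracket-mono ps)

-- Bounded b xs : i + xs[i] < b for every i < b.
Bounded : ℕ → List ℕ → Set
Bounded zero    xs       = ⊤
Bounded (suc b) []       = ⊤
Bounded (suc b) (x ∷ xs) = x < suc b × Bounded b xs

Bounded-++ : ∀ xs {k m ys} → length xs ≡ k → Bounded k xs → Bounded m ys → Bounded (k + m) (xs ++ ys)
Bounded-++ []       refl _        h' = h'
Bounded-++ (x ∷ xs) {suc k} {m} e (p , h) h' = ≤-trans p (s≤s (m≤m+n k m)) , Bounded-++ xs (suc-injective e) h h'

Bounded-extend : ∀ xs {k ys} → length xs ≡ k → Bounded k xs → Bounded k (xs ++ ys)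
Bounded-extend []       refl _       = tt
Bounded-extend (x ∷ xs) {suc k} e (p , h) = p , Bounded-extend xs (suc-injective e) h

Bounded-prefix : ∀ xs {k ys} → Bounded k (xs ++ ys) → Bounded k xs
Bounded-prefix []       {zero}  _       = tt
Bounded-prefix []       {suc k} _       = tt
Bounded-prefix (x ∷ xs) {zero}  _       = tt
Bounded-prefix (x ∷ xs) {suc k} (p , h) = p , Bounded-prefix xs h

Bounded-antimono : ∀ {k xs ys} → xs ≤ᵥ ys → Bounded k ys → Bounded k xs
Bounded-antimono {zero}  _        _       = tt
Bounded-antimono {suc k} []       _       = tt
Bounded-antimono {suc k} (q ∷ qs) (r , h) = ≤-<-trans q r , Bounded-antimono qs h

Bounded-at : ∀ xs {b y ys} → Bounded b (xs ++ y ∷ ys) → length xs < b → length xs + y < b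
Bounded-at []       {suc b} (p , _) _         = p
Bounded-at (x ∷ xs) {suc b} (_ , h) (s≤s lt) = s≤s (Bounded-at xs h lt)

Bounded-drop : ∀ xs {b y ys} → Bounded b (xs ++ y ∷ ys) → Bounded (b ∸ suc (length xs)) ys
Bounded-drop []       {zero}  _       = tt
Bounded-drop []       {suc b} (_ , h) = h
Bounded-drop (x ∷ xs) {zero}  _       = tt
Bounded-drop (x ∷ xs) {suc b} (_ , h) = Bounded-drop xs h

bracket-bounded : ∀ t → Bounded (size t) (bracket t)
bracket-bounded leaf       = tt
bracket-bounded (node a b) = subst (λ k → Bounded k (bracket (node a b))) (+-suc (size a) (size b))
  (Bounded-++ (bracket a) (length-bracket a) (bracket-bounded a) (≤-refl , bracket-bounded b))

-- the in-order position of the root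
rootPos : Tree → ℕ
rootPos leaf       = 0
rootPos (node a b) = size a

bracket-bounded-rootPos : ∀ t → Bounded (rootPos t) (bracket t)
bracket-bounded-rootPos leaf       = tt
bracket-bounded-rootPos (node a b) = Bounded-extend (bracket a) (length-bracket a) (bracket-bounded a)

rootPos<size : ∀ s n → size s ≡ suc n → rootPos s < suc n
rootPos<size (node a b) n e = subst (size a <_) e (s≤s (m≤m+n _ _))

plug : List Tree → Tree → Tree
plug []      u = u
plug (z ∷ C) u = node (plug C u) z

bracket-plug : ∀ C x y → bracket (plug C (node x y)) ≡ bracket x ++ size y ∷ bracket (plug C y)
bracket-plug []      x y = refl
bracket-plug (z ∷ C) x y =
  trans (cong (_++ size z ∷ bracket z) (bracket-plug C x y))
        (++-assoc (bracket x) (size y ∷ bracket (plug C y)) (size z ∷ bracket z))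

size-plug : ∀ C x y → size (plug C (node x y)) ≡ suc (size x + size (plug C y))
size-plug []      x y = refl
size-plug (z ∷ C) x y = trans (cong (λ k → suc (k + size z)) (size-plug C x y)) (size-rot x (plug C y) z)

plug-mono : ∀ C {a a'} → a ≤ₜ a' → plug C a ≤ₜ plug C a'
plug-mono []      p = p
plug-mono (z ∷ C) p = ≤ₜ-congˡ z (plug-mono C p)

plug-rotate : ∀ C x y → plug C (node x y) ≤ₜ node x (plug C y)
plug-rotate []      x y = ε
plug-rotate (z ∷ C) x y = ≤ₜ-congˡ z (plug-rotate C x y) ◅◅ (rot x (plug C y) z ◅ ε)

leftSpine-split : ∀ s b → b < size s → Bounded b (bracket s) →
                  Σ (List Tree) λ C → Σ Tree λ x → Σ Tree λ y → (s ≡ plug C (node x y)) × (size x ≡ b)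
leftSpine-split (node s₁ s₂) b lt h with <-cmp (size s₁) b
... | tri≈ _ e _ = [] , s₁ , s₂ , refl , e
... | tri< s₁<b _ _ = ⊥-elim (<⇒≱ too-big (≤-pred lt))
  where
    too-big : size s₁ + size s₂ < b
    too-big = subst (λ k → k + size s₂ < b) (length-bracket s₁)
      (Bounded-at (bracket s₁) h (subst (_< b) (sym (length-bracket s₁)) s₁<b))
... | tri> _ _ b<s₁ =
  let (C , x , y , e , sx) = leftSpine-split s₁ b b<s₁ (Bounded-prefix (bracket s₁) h)
  in s₂ ∷ C , x , y , cong (λ u → node u s₂) e , sx

-- Rotate to the root the left-spine node of s whose left subtree is as large as that of t, and recurse.
bracket-reflect : ∀ t s → size s ≡ size t → bracket s ≤ᵥ bracket t → s ≤ₜ t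
bracket-reflect leaf          leaf _ _ = ε
bracket-reflect (node t₁ t₂) s e p
  with leftSpine-split s (size t₁) (subst (size t₁ <_) (sym e) (s≤s (m≤m+n (size t₁) (size t₂))))
                       (Bounded-antimono p (bracket-bounded-rootPos (node t₁ t₂)))
... | C , x , y , refl , sx =
  plug-mono C (≤ₜ-congˡ y (bracket-reflect t₁ x sx x≤t₁)) ◅◅ plug-rotate C t₁ y
    ◅◅ ≤ₜ-congʳ t₁ (bracket-reflect t₂ (plug C y) size-rest rest≤t₂)
  where
    split = Pointwise-++⁻ (bracket x) (trans (length-bracket x) (trans sx (sym (length-bracket t₁))))
              (subst (_≤ᵥ bracket (node t₁ t₂)) (bracket-plug C x y) p)
    x≤t₁ : bracket x ≤ᵥ bracket t₁
    x≤t₁ = proj₁ split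
    rest≤t₂ : bracket (plug C y) ≤ᵥ bracket t₂
    rest≤t₂ = Pointwise.tail (proj₂ split)
    size-rest : size (plug C y) ≡ size t₂
    size-rest = +-cancelˡ-≡ (size t₁) _ _ (suc-injective
      (trans (sym (trans (size-plug C x y) (cong (λ k → suc (k + size (plug C y))) sx))) e))

⊓ᵥ-cong-middle : ∀ xs ys {m m' a us us' zs} → length xs ≡ length ys → a ≤ m → a ≤ m' →
                 us ⊓ᵥ zs ≡ us' ⊓ᵥ zs → (xs ++ m ∷ us) ⊓ᵥ (ys ++ a ∷ zs) ≡ (xs ++ m' ∷ us') ⊓ᵥ (ys ++ a ∷ zs)
⊓ᵥ-cong-middle []       []       _ a≤m a≤m' e = cong₂ _∷_ (trans (m≥n⇒m⊓n≡n a≤m) (sym (m≥n⇒m⊓n≡n a≤m'))) e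
⊓ᵥ-cong-middle (x ∷ xs) (y ∷ ys) l a≤m a≤m' e = cong (x ⊓ y ∷_) (⊓ᵥ-cong-middle xs ys (suc-injective l) a≤m a≤m' e)

rotateˡ : Tree → Tree → Tree
rotateˡ A leaf         = node A leaf
rotateˡ A (node X R') = node (node A X) R'

-- raise s b rotates left along the right spine until at least b nodes precede the root
raise : Tree → ℕ → Tree
raise leaf       b = leaf
raise (node A R) b with b ≤? size A
... | yes _ = node A R
... | no  _ = rotateˡ A (raise R (b ∸ suc (size A)))

AgreeBelow : ℕ → Tree → Tree → Set
AgreeBelow b s' s = ∀ y → length y ≡ size s → Bounded b y → bracket s' ⊓ᵥ y ≡ bracket s ⊓ᵥ y

RaiseSpec : Tree → Tree → ℕ → Set
RaiseSpec s' s b = (size s' ≡ size s) × (b ≤ rootPos s') × AgreeBelow b s' s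

-- The rotation changes a single bracket entry, size R to size X, and a b-bounded vector is at most
-- both there.
rotateˡ-spec : ∀ A R b → size A < b → b < size (node A R) →
               ∀ r → RaiseSpec r R (b ∸ suc (size A)) → RaiseSpec (rotateˡ A r) (node A R) b
rotateˡ-spec A R b A<b b<AR leaf (r≡R , _) = ⊥-elim (<⇒≱ b<AR (subst (λ k → suc (size A + k) ≤ b) r≡R A+0<b))
  where
    A+0<b : size A + 0 < b
    A+0<b = subst (_< b) (sym (+-identityʳ (size A))) A<b
rotateˡ-spec A R b A<b b<AR (node X R') (XR'≡R , b'≤X , agree) =
  trans (size-rot A X R') (cong (λ k → suc (size A + k)) XR'≡R) , b≤AX , agree'
  where
    b' = b ∸ suc (size A)
    b'+A : b' + suc (size A) ≡ b
    b'+A = m∸n+n≡m A<b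
    b≤AX : b ≤ suc (size A + size X)
    b≤AX = subst₂ _≤_ b'+A (trans (+-suc (size X) (size A)) (cong suc (+-comm (size X) (size A))))
                  (+-monoˡ-≤ (suc (size A)) b'≤X)
    X≤R : size X ≤ size R
    X≤R = subst (size X ≤_) XR'≡R (m≤n⇒m≤1+n (m≤m+n _ _))
    agree' : AgreeBelow b (node (node A X) R') (node A R)
    agree' y ly hy with splitAtIndex y (size A) (subst (size A <_) (sym ly) (s≤s (m≤m+n _ _)))
    ... | ys , a , zs , refl , lys =
      trans (cong (_⊓ᵥ (ys ++ a ∷ zs)) (++-assoc (bracket A) (size X ∷ bracket X) (size R' ∷ bracket R')))
            (⊓ᵥ-cong-middle (bracket A) ys (trans (length-bracket A) (sym lys)) a≤X (≤-trans a≤X X≤R)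
              (agree zs lzs (subst (λ k → Bounded (b ∸ suc k) zs) lys (Bounded-drop ys hy))))
      where
        lzs : length zs ≡ size R
        lzs = suc-injective (+-cancelˡ-≡ (size A) _ _ (begin
          size A + length (a ∷ zs)    ≡⟨ cong (_+ length (a ∷ zs)) (sym lys) ⟩
          length ys + length (a ∷ zs) ≡⟨ sym (length-++ ys) ⟩
          length (ys ++ a ∷ zs)       ≡⟨ ly ⟩
          suc (size A + size R)       ≡⟨ sym (+-suc (size A) (size R)) ⟩
          size A + suc (size R)       ∎))
          where open ≡-Reasoning
        A+a<b : size A + a < b
        A+a<b = subst (λ k → k + a < b) lys (Bounded-at ys hy (subst (_< b) (sym lys) A<b))
        a≤X : a ≤ size X
        a≤X = ≤-trans (m+n≤o⇒m≤o∸n a (subst (_≤ b) (trans (cong suc (+-comm (size A) a)) (sym (+-suc a (size A)))) A+a<b))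
                      b'≤X

raise-spec : ∀ s b → b < size s → RaiseSpec (raise s b) s b
raise-spec (node A R) b b<AR with b ≤? size A
... | yes b≤A = refl , b≤A , λ _ _ _ → refl
... | no  b≰A = rotateˡ-spec A R b A<b b<AR (raise R b') (raise-spec R b' b'<R)
  where
    A<b : size A < b
    A<b = ≰⇒> b≰A
    b' = b ∸ suc (size A)
    b'<R : b' < size R
    b'<R = +-cancelʳ-≤ (suc (size A)) (suc b') (size R)
      (subst₂ _≤_ (cong suc (sym (m∸n+n≡m A<b)))
                  (trans (cong suc (+-comm (size A) (size R))) (sym (+-suc (size R) (size A)))) b<AR)

-- sync g s t raises the tree whose root comes first until both roots sit at the same position
sync : ℕ → Tree → Tree → Tree × Tree
sync zero    s t = s , t
sync (suc g) s t with <-cmp (rootPos s) (rootPos t)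
... | tri< _ _ _ = sync g (raise s (rootPos t)) t
... | tri≈ _ _ _ = s , t
... | tri> _ _ _ = sync g s (raise t (rootPos s))

SyncSpec : ℕ → Tree → Tree → Tree × Tree → Set
SyncSpec n s t (s' , t') = (size s' ≡ suc n) × (size t' ≡ suc n) × (rootPos s' ≡ rootPos t')
                         × (bracket s' ⊓ᵥ bracket t' ≡ bracket s ⊓ᵥ bracket t)

fuel-step : ∀ g {p q} → p < q → suc g + p ≤ g + q
fuel-step g {p} {q} p<q = subst (_≤ g + q) (+-suc g p) (+-monoʳ-≤ g p<q)

-- the fuel g suffices because each raise strictly increases a root position, which stays below suc n
sync-spec : ∀ g s t n → size s ≡ suc n → size t ≡ suc n → suc n ≤ g + rootPos s → suc n ≤ g + rootPos t →
            SyncSpec n s t (sync g s t)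
sync-spec zero s t n es _ fuel _ = ⊥-elim (<⇒≱ (rootPos<size s n es) fuel)
sync-spec (suc g) s t n es et fuelˢ fuelᵗ with <-cmp (rootPos s) (rootPos t)
... | tri≈ _ e _ = es , et , e , refl
... | tri< s<t _ _ =
  let (size-s' , t≤s' , agree) = raise-spec s (rootPos t) (subst (rootPos t <_) (sym es) (rootPos<size t n et))
      (q₁ , q₂ , q₃ , q₄) = sync-spec g (raise s (rootPos t)) t n (trans size-s' es) et
                              (≤-trans fuelˢ (fuel-step g (≤-trans s<t t≤s'))) (≤-trans fuelˢ (fuel-step g s<t))
  in q₁ , q₂ , q₃ , trans q₄ (agree (bracket t) (trans (length-bracket t) (trans et (sym es))) (bracket-bounded-rootPos t))
... | tri> _ _ t<s =
  let (size-t' , s≤t' , agree) = raise-spec t (rootPos s) (subst (rootPos s <_) (sym et) (rootPos<size s n es))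
      (q₁ , q₂ , q₃ , q₄) = sync-spec g s (raise t (rootPos s)) n es (trans size-t' et)
                              (≤-trans fuelᵗ (fuel-step g t<s)) (≤-trans fuelᵗ (fuel-step g (≤-trans t<s s≤t')))
  in q₁ , q₂ , q₃ , trans q₄ (trans (⊓ᵥ-comm (bracket s) _)
       (trans (agree (bracket s) (trans (length-bracket s) (trans es (sym et))) (bracket-bounded-rootPos s))
              (⊓ᵥ-comm _ (bracket s))))

-- meet f s t, with fuel f ≥ size s: synchronise the roots, then recurse into both subtrees
meet : ℕ → Tree → Tree → Tree
meetSynced : ℕ → Tree × Tree → Tree
meet zero    s t = leaf
meet (suc f) s t = meetSynced f (sync (size s) s t)
meetSynced f (node s₁ s₂ , node t₁ t₂) = node (meet f s₁ t₁) (meet f s₂ t₂)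
meetSynced f (leaf , _)                = leaf
meetSynced f (node _ _ , leaf)         = leaf

bracket-meet : ∀ f s t → size s ≡ size t → size s ≤ f → bracket (meet f s t) ≡ bracket s ⊓ᵥ bracket t
bracket-meetSynced : ∀ f n s t p → SyncSpec n s t p → suc n ≤ suc f → bracket (meetSynced f p) ≡ bracket s ⊓ᵥ bracket t
bracket-meet zero    leaf leaf _ _ = refl
bracket-meet (suc f) leaf leaf _ _ = refl
bracket-meet (suc f) (node a b) t e le =
  bracket-meetSynced f (size a + size b) (node a b) t (sync (size (node a b)) (node a b) t)
    (sync-spec (size (node a b)) (node a b) t (size a + size b) refl (sym e) (m≤m+n _ _) (m≤m+n _ _)) le
bracket-meetSynced f n s t (node s₁ s₂ , node t₁ t₂) (q₁ , q₂ , q₃ , q₄) le = trans bracket-node q₄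
  where
    s₂≡t₂ : size s₂ ≡ size t₂
    s₂≡t₂ = +-cancelˡ-≡ (size s₁) _ _ (suc-injective (trans q₁ (trans (sym q₂) (cong (λ k → suc (k + size t₂)) (sym q₃)))))
    s₁≤f : size s₁ ≤ f
    s₁≤f = ≤-pred (≤-trans (subst (suc (size s₁) ≤_) q₁ (s≤s (m≤m+n _ _))) le)
    s₂≤f : size s₂ ≤ f
    s₂≤f = ≤-pred (≤-trans (subst (suc (size s₂) ≤_) q₁ (s≤s (m≤n+m _ _))) le)
    l₂ : length (bracket s₂) ≡ length (bracket t₂)
    l₂ = trans (length-bracket s₂) (trans s₂≡t₂ (sym (length-bracket t₂)))
    size-meet₂ : size (meet f s₂ t₂) ≡ size s₂ ⊓ size t₂
    size-meet₂ = begin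
      size (meet f s₂ t₂)                    ≡⟨ sym (length-bracket _) ⟩
      length (bracket (meet f s₂ t₂))        ≡⟨ cong length (bracket-meet f s₂ t₂ s₂≡t₂ s₂≤f) ⟩
      length (bracket s₂ ⊓ᵥ bracket t₂)      ≡⟨ length-⊓ᵥ (bracket s₂) (bracket t₂) l₂ ⟩
      length (bracket s₂)                    ≡⟨ length-bracket s₂ ⟩
      size s₂                                ≡⟨ sym (⊓-idem (size s₂)) ⟩
      size s₂ ⊓ size s₂                      ≡⟨ cong (size s₂ ⊓_) s₂≡t₂ ⟩
      size s₂ ⊓ size t₂                      ∎
      where open ≡-Reasoning
    bracket-node : bracket (node (meet f s₁ t₁) (meet f s₂ t₂)) ≡ bracket (node s₁ s₂) ⊓ᵥ bracket (node t₁ t₂)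
    bracket-node =
      trans (cong₂ _++_ (bracket-meet f s₁ t₁ q₃ s₁≤f) (cong₂ _∷_ size-meet₂ (bracket-meet f s₂ t₂ s₂≡t₂ s₂≤f)))
            (sym (⊓ᵥ-++ (bracket s₁) (bracket t₁) (trans (length-bracket s₁) (trans q₃ (sym (length-bracket t₁))))))
bracket-meetSynced f n s t (leaf , _)        (q₁ , _) _ = ⊥-elim (0≢1+n q₁)
bracket-meetSynced f n s t (node _ _ , leaf) (_ , q₂ , _) _ = ⊥-elim (0≢1+n q₂)

T-≡ : ∀ {n} {s t : T n} → proj₁ s ≡ proj₁ t → s ≡ t
T-≡ {s = s , p} {t = .s , q} refl = cong (s ,_) (≡-irrelevant p q)

module _ {n : ℕ} where

  length-bracket-T : (s t : T n) → length (bracket (proj₁ s)) ≡ length (bracket (proj₁ t))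
  length-bracket-T (s , ps) (t , pt) = trans (length-bracket s) (trans ps (trans (sym pt) (sym (length-bracket t))))

  bracket-meetT : (s t : T n) → bracket (meet n (proj₁ s) (proj₁ t)) ≡ bracket (proj₁ s) ⊓ᵥ bracket (proj₁ t)
  bracket-meetT (s , ps) (t , pt) = bracket-meet n s t (trans ps (sym pt)) (≤-reflexive ps)

  size-meetT : (s t : T n) → size (meet n (proj₁ s) (proj₁ t)) ≡ n
  size-meetT s t = begin
    size (meet n (proj₁ s) (proj₁ t))              ≡⟨ sym (length-bracket _) ⟩
    length (bracket (meet n (proj₁ s) (proj₁ t)))  ≡⟨ cong length (bracket-meetT s t) ⟩
    length (bracket (proj₁ s) ⊓ᵥ bracket (proj₁ t)) ≡⟨ length-⊓ᵥ (bracket (proj₁ s)) (bracket (proj₁ t)) (length-bracket-T s t) ⟩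
    length (bracket (proj₁ s))                     ≡⟨ length-bracket (proj₁ s) ⟩
    size (proj₁ s)                                 ≡⟨ proj₂ s ⟩
    n                                              ∎
    where open ≡-Reasoning

  meetT : T n → T n → T n
  meetT s t = meet n (proj₁ s) (proj₁ t) , size-meetT s t

  ≤T-from-bracket : {s t : T n} → bracket (proj₁ s) ≤ᵥ bracket (proj₁ t) → s ≤T t
  ≤T-from-bracket {s} {t} = bracket-reflect (proj₁ t) (proj₁ s) (trans (proj₂ s) (sym (proj₂ t)))

  meetT-≤ˡ : (s t : T n) → meetT s t ≤T s
  meetT-≤ˡ s t = ≤T-from-bracket {meetT s t} {s}
    (subst (_≤ᵥ bracket (proj₁ s)) (sym (bracket-meetT s t)) (⊓ᵥ-≤ˡ (bracket (proj₁ s)) (bracket (proj₁ t)) (length-bracket-T s t)))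

  meetT-≤ʳ : (s t : T n) → meetT s t ≤T t
  meetT-≤ʳ s t = ≤T-from-bracket {meetT s t} {t}
    (subst (_≤ᵥ bracket (proj₁ t)) (sym (bracket-meetT s t)) (⊓ᵥ-≤ʳ (bracket (proj₁ s)) (bracket (proj₁ t)) (length-bracket-T s t)))

  meetT-greatest : (s t u : T n) → u ≤T s → u ≤T t → u ≤T meetT s t
  meetT-greatest s t u p q =
    ≤T-from-bracket {u} {meetT s t} (subst (bracket (proj₁ u) ≤ᵥ_) (sym (bracket-meetT s t)) (⊓ᵥ-glb (bracket-mono p) (bracket-mono q)))

mirror : Tree → Tree
mirror leaf       = leaf
mirror (node a b) = node (mirror b) (mirror a)

size-mirror : ∀ t → size (mirror t) ≡ size t
size-mirror leaf       = refl
size-mirror (node a b) = cong suc (trans (cong₂ _+_ (size-mirror b) (size-mirror a)) (+-comm (size b) (size a)))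

mirror-involutive : ∀ t → mirror (mirror t) ≡ t
mirror-involutive leaf       = refl
mirror-involutive (node a b) = cong₂ node (mirror-involutive a) (mirror-involutive b)

TStep-mirror : ∀ {s t} → TStep s t → TStep (mirror t) (mirror s)
TStep-mirror (rot x y z) = rot (mirror z) (mirror y) (mirror x)
TStep-mirror (congˡ t p) = congʳ (mirror t) (TStep-mirror p)
TStep-mirror (congʳ s p) = congˡ (mirror s) (TStep-mirror p)

≤ₜ-mirror : ∀ {s t} → s ≤ₜ t → mirror t ≤ₜ mirror s
≤ₜ-mirror ε        = ε
≤ₜ-mirror (p ◅ ps) = ≤ₜ-mirror ps ◅◅ (TStep-mirror p ◅ ε)

module _ {n : ℕ} where

  mirrorT : T n → T n
  mirrorT (t , p) = mirror t , trans (size-mirror t) p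

  ≤T-mirror : {s t : T n} → s ≤T t → mirrorT t ≤T mirrorT s
  ≤T-mirror = ≤ₜ-mirror

  ≤T-unmirror : {s t : T n} → mirrorT s ≤T mirrorT t → t ≤T s
  ≤T-unmirror {s} {t} p = subst₂ _≤ₜ_ (mirror-involutive (proj₁ t)) (mirror-involutive (proj₁ s)) (≤ₜ-mirror p)

  joinT : T n → T n → T n
  joinT s t = mirrorT (meetT (mirrorT s) (mirrorT t))

  joinT-≥ˡ : (s t : T n) → s ≤T joinT s t
  joinT-≥ˡ s t = ≤T-unmirror {joinT s t} {s}
    (subst (_≤ₜ mirror (proj₁ s)) (sym (mirror-involutive _)) (meetT-≤ˡ (mirrorT s) (mirrorT t)))

  joinT-≥ʳ : (s t : T n) → t ≤T joinT s t
  joinT-≥ʳ s t = ≤T-unmirror {joinT s t} {t}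
    (subst (_≤ₜ mirror (proj₁ t)) (sym (mirror-involutive _)) (meetT-≤ʳ (mirrorT s) (mirrorT t)))

  joinT-least : (s t u : T n) → s ≤T u → t ≤T u → joinT s t ≤T u
  joinT-least s t u p q = ≤T-unmirror {u} {joinT s t}
    (subst (mirror (proj₁ u) ≤ₜ_) (sym (mirror-involutive _))
      (meetT-greatest (mirrorT s) (mirrorT t) (mirrorT u) (≤T-mirror {s} {u} p) (≤T-mirror {t} {u} q)))

-- Antisymmetry: a rotation strictly increases the total size of right subtrees

rightWeight : Tree → ℕ
rightWeight leaf       = 0
rightWeight (node a b) = rightWeight a + rightWeight b + size b

TStep-rightWeight : ∀ {s t} → TStep s t → rightWeight s < rightWeight t
TStep-rightWeight (rot x y z) =
  subst (rightWeight (node (node x y) z) <_) (lemma (rightWeight x) (rightWeight y) (rightWeight z) (size y) (size z))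
        (s≤s (m≤m+n (rightWeight (node (node x y) z)) (size z)))
  where
    lemma : ∀ wx wy wz y z → suc (wx + wy + y + wz + z + z) ≡ wx + (wy + wz + z) + suc (y + z)
    lemma = solve-∀
TStep-rightWeight (congˡ t p) = +-monoˡ-< (size t) (+-monoˡ-< (rightWeight t) (TStep-rightWeight p))
TStep-rightWeight (congʳ s {t} {t'} p) =
  subst (λ k → rightWeight s + rightWeight t + size t < rightWeight s + rightWeight t' + k) (TStep-size p)
    (+-monoˡ-< (size t) (+-monoʳ-< (rightWeight s) (TStep-rightWeight p)))

≤ₜ-rightWeight : ∀ {s t} → s ≤ₜ t → rightWeight s ≤ rightWeight t
≤ₜ-rightWeight ε        = ≤-refl
≤ₜ-rightWeight (p ◅ ps) = ≤-trans (<⇒≤ (TStep-rightWeight p)) (≤ₜ-rightWeight ps)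

≤ₜ-antisym : ∀ {s t} → s ≤ₜ t → t ≤ₜ s → s ≡ t
≤ₜ-antisym ε        _ = refl
≤ₜ-antisym (p ◅ ps) q = ⊥-elim (<⇒≱ (TStep-rightWeight p) (≤-trans (≤ₜ-rightWeight ps) (≤ₜ-rightWeight q)))

-- Going up, a product grafts its two
-- input trees and a coproduct passes its input on the left and starts a leaf on the right;
-- going down the roles are exchanged, and a coproduct grafts the tree of its right output as
-- the left subtree, so that the coproduct rotation becomes a Tamari rotation.

sprout : ℕ → List Tree → List Tree
sprout _       []       = []
sprout zero    (t ∷ ts) = t ∷ leaf ∷ ts
sprout (suc i) (t ∷ ts) = t ∷ sprout i ts

combine : (Tree → Tree → Tree) → ℕ → List Tree → List Tree
combine c _       []           = []
combine c zero    (a ∷ [])     = a ∷ []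
combine c zero    (a ∷ b ∷ ts) = c a b ∷ ts
combine c (suc i) (t ∷ ts)     = t ∷ combine c i ts

flipNode : Tree → Tree → Tree
flipNode a b = node b a

stepUp : Layer → List Tree → List Tree
stepUp (co , i) = sprout i
stepUp (pr , i) = combine node i

stepDown : Layer → List Tree → List Tree
stepDown (co , i) = combine flipNode i
stepDown (pr , i) = sprout i

evalUp : Diagram → List Tree → List Tree
evalUp []      xs = xs
evalUp (l ∷ D) xs = evalUp D (stepUp l xs)

evalDown : Diagram → List Tree → List Tree
evalDown []      xs = xs
evalDown (l ∷ D) xs = stepDown l (evalDown D xs)

evalUp-++ : ∀ A B xs → evalUp (A ++ B) xs ≡ evalUp B (evalUp A xs)
evalUp-++ []      B xs = refl
evalUp-++ (l ∷ A) B xs = evalUp-++ A B (stepUp l xs)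

evalDown-++ : ∀ A B xs → evalDown (A ++ B) xs ≡ evalDown A (evalDown B xs)
evalDown-++ []      B xs = refl
evalDown-++ (l ∷ A) B xs = cong (stepDown l) (evalDown-++ A B xs)

headTree : List Tree → Tree
headTree []      = leaf
headTree (t ∷ _) = t

coproductTree : Diagram → Tree
coproductTree D = headTree (evalDown D (leaf ∷ []))

productTree : Diagram → Tree
productTree D = headTree (evalUp D (leaf ∷ []))

Positional : (ℕ → List Tree → List Tree) → Set
Positional f = (∀ k y ys → f (suc k) (y ∷ ys) ≡ y ∷ f k ys) × (∀ k → f k [] ≡ [])

sprout-positional : Positional sprout
sprout-positional = (λ _ _ _ → refl) , λ { zero → refl ; (suc k) → refl }

combine-positional : ∀ c → Positional (combine c)
combine-positional c = (λ _ _ _ → refl) , λ { zero → refl ; (suc k) → refl }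

stepUp-positional : ∀ g → Positional (λ k → stepUp (g , k))
stepUp-positional co = sprout-positional
stepUp-positional pr = combine-positional node

stepDown-positional : ∀ g → Positional (λ k → stepDown (g , k))
stepDown-positional co = combine-positional flipNode
stepDown-positional pr = sprout-positional

sprout-commute : ∀ f → Positional f → ∀ i k ys → i < k → f (suc k) (sprout i ys) ≡ sprout i (f k ys)
sprout-commute f (f-∷ , f-[]) i k [] _ = trans (f-[] (suc k)) (cong (sprout i) (sym (f-[] k)))
sprout-commute f (f-∷ , f-[]) zero (suc k) (y ∷ ys) _ =
  trans (f-∷ (suc k) y (leaf ∷ ys)) (trans (cong (y ∷_) (f-∷ k leaf ys)) (cong (sprout zero) (sym (f-∷ k y ys))))
sprout-commute f (f-∷ , f-[]) (suc i) (suc k) (y ∷ ys) (s≤s i<k) =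
  trans (f-∷ (suc k) y _) (trans (cong (y ∷_) (sprout-commute f (f-∷ , f-[]) i k ys i<k)) (cong (sprout (suc i)) (sym (f-∷ k y ys))))

combine-commute : ∀ c f → Positional f → ∀ i j ys → i < j → f j (combine c i ys) ≡ combine c i (f (suc j) ys)
combine-commute c f (f-∷ , f-[]) zero j [] _ = trans (f-[] j) (cong (combine c zero) (sym (f-[] (suc j))))
combine-commute c f (f-∷ , f-[]) (suc i) j [] _ = trans (f-[] j) (cong (combine c (suc i)) (sym (f-[] (suc j))))
combine-commute c f (f-∷ , f-[]) zero (suc j) (a ∷ []) _ =
  trans (f-∷ j a []) (trans (cong (a ∷_) (f-[] j))
    (sym (trans (cong (combine c zero) (f-∷ (suc j) a [])) (cong (λ l → combine c zero (a ∷ l)) (f-[] (suc j))))))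
combine-commute c f (f-∷ , f-[]) zero (suc j) (a ∷ b ∷ ys) _ =
  trans (f-∷ j (c a b) ys) (cong (combine c zero) (sym (trans (f-∷ (suc j) a (b ∷ ys)) (cong (a ∷_) (f-∷ j b ys)))))
combine-commute c f (f-∷ , f-[]) (suc i) (suc j) (y ∷ ys) (s≤s i<j) =
  trans (f-∷ j y _) (trans (cong (y ∷_) (combine-commute c f (f-∷ , f-[]) i j ys i<j)) (cong (combine c (suc i)) (sym (f-∷ (suc j) y ys))))

⇄-evalUp : ∀ {D D'} → D ⇄ D' → ∀ xs → evalUp D xs ≡ evalUp D' xs
⇄-evalUp (swap-co pre post i k g i<k) xs = begin
  evalUp (pre ++ _) xs             ≡⟨ evalUp-++ pre _ xs ⟩
  evalUp post (stepUp (g , suc k) (sprout i (evalUp pre xs)))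
    ≡⟨ cong (evalUp post) (sprout-commute _ (stepUp-positional g) i k (evalUp pre xs) i<k) ⟩
  evalUp post (sprout i (stepUp (g , k) (evalUp pre xs))) ≡⟨ evalUp-++ pre _ xs ⟨
  evalUp (pre ++ _) xs             ∎
  where open ≡-Reasoning
⇄-evalUp (swap-pr pre post i j g i<j) xs = begin
  evalUp (pre ++ _) xs             ≡⟨ evalUp-++ pre _ xs ⟩
  evalUp post (stepUp (g , j) (combine node i (evalUp pre xs)))
    ≡⟨ cong (evalUp post) (combine-commute node _ (stepUp-positional g) i j (evalUp pre xs) i<j) ⟩
  evalUp post (combine node i (stepUp (g , suc j) (evalUp pre xs))) ≡⟨ evalUp-++ pre _ xs ⟨
  evalUp (pre ++ _) xs             ∎
  where open ≡-Reasoning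

⇄-evalDown : ∀ {D D'} → D ⇄ D' → ∀ xs → evalDown D xs ≡ evalDown D' xs
⇄-evalDown (swap-co pre post i k g i<k) xs = begin
  evalDown (pre ++ _) xs             ≡⟨ evalDown-++ pre _ xs ⟩
  evalDown pre (combine flipNode i (stepDown (g , suc k) (evalDown post xs)))
    ≡⟨ cong (evalDown pre) (combine-commute flipNode _ (stepDown-positional g) i k (evalDown post xs) i<k) ⟨
  evalDown pre (stepDown (g , k) (combine flipNode i (evalDown post xs))) ≡⟨ evalDown-++ pre _ xs ⟨
  evalDown (pre ++ _) xs             ∎
  where open ≡-Reasoning
⇄-evalDown (swap-pr pre post i j g i<j) xs = begin
  evalDown (pre ++ _) xs             ≡⟨ evalDown-++ pre _ xs ⟩
  evalDown pre (sprout i (stepDown (g , j) (evalDown post xs)))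
    ≡⟨ cong (evalDown pre) (sprout-commute _ (stepDown-positional g) i j (evalDown post xs) i<j) ⟨
  evalDown pre (stepDown (g , suc j) (sprout i (evalDown post xs))) ≡⟨ evalDown-++ pre _ xs ⟨
  evalDown (pre ++ _) xs             ∎
  where open ≡-Reasoning

≅-evalUp : ∀ {D D'} → D ≅ D' → ∀ xs → evalUp D xs ≡ evalUp D' xs
≅-evalUp iso xs = EqClosure.gfold isEquivalence (λ D → evalUp D xs) (λ p → ⇄-evalUp p xs) iso

≅-evalDown : ∀ {D D'} → D ≅ D' → ∀ xs → evalDown D xs ≡ evalDown D' xs
≅-evalDown iso xs = EqClosure.gfold isEquivalence (λ D → evalDown D xs) (λ p → ⇄-evalDown p xs) iso

≅-coproductTree : ∀ {D D'} → D ≅ D' → coproductTree D ≡ coproductTree D'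
≅-coproductTree iso = cong headTree (≅-evalDown iso (leaf ∷ []))

≅-productTree : ∀ {D D'} → D ≅ D' → productTree D ≡ productTree D'
≅-productTree iso = cong headTree (≅-evalUp iso (leaf ∷ []))

infix 4 _≤ₜ*_
_≤ₜ*_ : List Tree → List Tree → Set
_≤ₜ*_ = Pointwise _≤ₜ_

≤ₜ*-reflexive : ∀ {xs ys} → xs ≡ ys → xs ≤ₜ* ys
≤ₜ*-reflexive refl = Pointwise.refl ε

sprout-mono : ∀ i {xs ys} → xs ≤ₜ* ys → sprout i xs ≤ₜ* sprout i ys
sprout-mono i       []       = []
sprout-mono zero    (p ∷ ps) = p ∷ ε ∷ ps
sprout-mono (suc i) (p ∷ ps) = p ∷ sprout-mono i ps

combine-mono : ∀ c → (∀ {a a' b b'} → a ≤ₜ a' → b ≤ₜ b' → c a b ≤ₜ c a' b') →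
               ∀ i {xs ys} → xs ≤ₜ* ys → combine c i xs ≤ₜ* combine c i ys
combine-mono c c-mono i       []           = []
combine-mono c c-mono zero    (p ∷ [])     = p ∷ []
combine-mono c c-mono zero    (p ∷ q ∷ ps) = c-mono p q ∷ ps
combine-mono c c-mono (suc i) (p ∷ ps)     = p ∷ combine-mono c c-mono i ps

stepUp-mono : ∀ l {xs ys} → xs ≤ₜ* ys → stepUp l xs ≤ₜ* stepUp l ys
stepUp-mono (co , i) = sprout-mono i
stepUp-mono (pr , i) = combine-mono node ≤ₜ-node i

stepDown-mono : ∀ l {xs ys} → xs ≤ₜ* ys → stepDown l xs ≤ₜ* stepDown l ys
stepDown-mono (co , i) = combine-mono flipNode (λ p q → ≤ₜ-node q p) i
stepDown-mono (pr , i) = sprout-mono i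

evalUp-mono : ∀ D {xs ys} → xs ≤ₜ* ys → evalUp D xs ≤ₜ* evalUp D ys
evalUp-mono []      p = p
evalUp-mono (l ∷ D) p = evalUp-mono D (stepUp-mono l p)

evalDown-mono : ∀ D {xs ys} → xs ≤ₜ* ys → evalDown D xs ≤ₜ* evalDown D ys
evalDown-mono []      p = p
evalDown-mono (l ∷ D) p = stepDown-mono l (evalDown-mono D p)

sprout-sprout : ∀ i ys → sprout (suc i) (sprout i ys) ≡ sprout i (sprout i ys)
sprout-sprout i       []       = refl
sprout-sprout zero    (y ∷ ys) = refl
sprout-sprout (suc i) (y ∷ ys) = cong (y ∷_) (sprout-sprout i ys)

combine-rotate : ∀ i ys → combine node i (combine node i ys) ≤ₜ* combine node i (combine node (suc i) ys)
combine-rotate i       []                = ≤ₜ*-reflexive refl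
combine-rotate zero    (a ∷ [])          = ≤ₜ*-reflexive refl
combine-rotate zero    (a ∷ b ∷ [])      = ≤ₜ*-reflexive refl
combine-rotate zero    (a ∷ b ∷ c ∷ ys) = (rot a b c ◅ ε) ∷ ≤ₜ*-reflexive refl
combine-rotate (suc i) (y ∷ ys)          = ε ∷ combine-rotate i ys

combine-flip-rotate : ∀ i ys → combine flipNode i (combine flipNode (suc i) ys) ≤ₜ* combine flipNode i (combine flipNode i ys)
combine-flip-rotate i       []                = ≤ₜ*-reflexive refl
combine-flip-rotate zero    (a ∷ [])          = ≤ₜ*-reflexive refl
combine-flip-rotate zero    (a ∷ b ∷ [])      = ≤ₜ*-reflexive refl
combine-flip-rotate zero    (a ∷ b ∷ c ∷ ys) = (rot c b a ◅ ε) ∷ ≤ₜ*-reflexive refl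
combine-flip-rotate (suc i) (y ∷ ys)          = ε ∷ combine-flip-rotate i ys

⟶-evalUp : ∀ {A B} → A ⟶ B → ∀ xs → evalUp A xs ≤ₜ* evalUp B xs
⟶-evalUp (rot-co pre post i) xs = ≤ₜ*-reflexive (begin
  evalUp (pre ++ _) xs                              ≡⟨ evalUp-++ pre _ xs ⟩
  evalUp post (sprout (suc i) (sprout i (evalUp pre xs))) ≡⟨ cong (evalUp post) (sprout-sprout i (evalUp pre xs)) ⟩
  evalUp post (sprout i (sprout i (evalUp pre xs)))       ≡⟨ evalUp-++ pre _ xs ⟨
  evalUp (pre ++ _) xs                              ∎)
  where open ≡-Reasoning
⟶-evalUp (rot-pr pre post i) xs =
  subst₂ _≤ₜ*_ (sym (evalUp-++ pre _ xs)) (sym (evalUp-++ pre _ xs)) (evalUp-mono post (combine-rotate i (evalUp pre xs)))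

⟶-evalDown : ∀ {A B} → A ⟶ B → ∀ xs → evalDown A xs ≤ₜ* evalDown B xs
⟶-evalDown (rot-co pre post i) xs =
  subst₂ _≤ₜ*_ (sym (evalDown-++ pre _ xs)) (sym (evalDown-++ pre _ xs)) (evalDown-mono pre (combine-flip-rotate i (evalDown post xs)))
⟶-evalDown (rot-pr pre post i) xs = ≤ₜ*-reflexive (begin
  evalDown (pre ++ _) xs                                 ≡⟨ evalDown-++ pre _ xs ⟩
  evalDown pre (sprout i (sprout i (evalDown post xs)))       ≡⟨ cong (evalDown pre) (sprout-sprout i (evalDown post xs)) ⟨
  evalDown pre (sprout (suc i) (sprout i (evalDown post xs))) ≡⟨ evalDown-++ pre _ xs ⟨
  evalDown (pre ++ _) xs                                 ∎)
  where open ≡-Reasoning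

≤ₜ*-headTree : ∀ {xs ys} → xs ≤ₜ* ys → headTree xs ≤ₜ headTree ys
≤ₜ*-headTree []      = ε
≤ₜ*-headTree (p ∷ _) = p

⟶-coproductTree : ∀ {A B} → A ⟶ B → coproductTree A ≤ₜ coproductTree B
⟶-coproductTree r = ≤ₜ*-headTree (⟶-evalDown r (leaf ∷ []))

⟶-productTree : ∀ {A B} → A ⟶ B → productTree A ≤ₜ productTree B
⟶-productTree r = ≤ₜ*-headTree (⟶-evalUp r (leaf ∷ []))

module ≅-Reasoning = SetoidReasoning (EqClosure.setoid _⇄_)

≅-reflexive : ∀ {A B} → A ≡ B → A ≅ B
≅-reflexive refl = ε

≅-sym : ∀ {A B} → A ≅ B → B ≅ A
≅-sym = EqClosure.symmetric _⇄_

private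
  reassociate : ∀ (L pre : Diagram) x y post R → (L ++ pre) ++ x ∷ y ∷ (post ++ R) ≡ L ++ (pre ++ x ∷ y ∷ post) ++ R
  reassociate L pre x y post R = trans (++-assoc L pre _) (cong (L ++_) (sym (++-assoc pre (x ∷ y ∷ post) R)))

⇄-cong : ∀ L R {A B} → A ⇄ B → (L ++ A ++ R) ⇄ (L ++ B ++ R)
⇄-cong L R (swap-co pre post i k g le) =
  subst₂ _⇄_ (reassociate L pre _ _ post R) (reassociate L pre _ _ post R) (swap-co (L ++ pre) (post ++ R) i k g le)
⇄-cong L R (swap-pr pre post i j g le) =
  subst₂ _⇄_ (reassociate L pre _ _ post R) (reassociate L pre _ _ post R) (swap-pr (L ++ pre) (post ++ R) i j g le)

⟶-cong : ∀ L R {A B} → A ⟶ B → (L ++ A ++ R) ⟶ (L ++ B ++ R)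
⟶-cong L R (rot-co pre post i) =
  subst₂ _⟶_ (reassociate L pre _ _ post R) (reassociate L pre _ _ post R) (rot-co (L ++ pre) (post ++ R) i)
⟶-cong L R (rot-pr pre post i) =
  subst₂ _⟶_ (reassociate L pre _ _ post R) (reassociate L pre _ _ post R) (rot-pr (L ++ pre) (post ++ R) i)

≅-cong : ∀ L R {A B} → A ≅ B → (L ++ A ++ R) ≅ (L ++ B ++ R)
≅-cong L R = EqClosure.gmap (λ D → L ++ D ++ R) (⇄-cong L R)

≅-congˡ : ∀ L {A B} → A ≅ B → (L ++ A) ≅ (L ++ B)
≅-congˡ L {A} {B} p = subst₂ _≅_ (cong (L ++_) (++-identityʳ A)) (cong (L ++_) (++-identityʳ B)) (≅-cong L [] p)

≅-congʳ : ∀ R {A B} → A ≅ B → (A ++ R) ≅ (B ++ R)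
≅-congʳ R = ≅-cong [] R

≅-∷ : ∀ l {A B} → A ≅ B → (l ∷ A) ≅ (l ∷ B)
≅-∷ l = ≅-congˡ (l ∷ [])

≅-swap-co : ∀ i k g post → suc i ≤ k → ((co , i) ∷ (g , suc k) ∷ post) ≅ ((g , k) ∷ (co , i) ∷ post)
≅-swap-co i k g post le = EqClosure.return (swap-co [] post i k g le)

≅-swap-pr : ∀ i j g post → suc i ≤ j → ((pr , i) ∷ (g , j) ∷ post) ≅ ((g , suc j) ∷ (pr , i) ∷ post)
≅-swap-pr i j g post le = EqClosure.return (swap-pr [] post i j g le)

-- Canonical diagrams: coDiagram t o has its root on wire o, prDiagram t o has its leftmost leaf on wire o.

coDiagram : Tree → ℕ → Diagram
coDiagram leaf       o = []
coDiagram (node x y) o = (co , o) ∷ coDiagram y o ++ coDiagram x (o + suc (size y))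

prDiagram : Tree → ℕ → Diagram
prDiagram leaf       o = []
prDiagram (node x y) o = prDiagram x o ++ prDiagram y (suc o) ++ (pr , o) ∷ []

coDiagrams : List Tree → ℕ → Diagram
coDiagrams []       o = []
coDiagrams (t ∷ ts) o = coDiagram t o ++ coDiagrams ts (o + suc (size t))

prDiagrams : List Tree → ℕ → Diagram
prDiagrams []       o = []
prDiagrams (t ∷ ts) o = prDiagram t o ++ prDiagrams ts (suc o)

canonical : Tree → Tree → Diagram
canonical c p = coDiagram c 0 ++ prDiagram p 0

shift : Diagram → Diagram
shift []            = []
shift ((g , k) ∷ D) = (g , suc k) ∷ shift D

shift-++ : ∀ A B → shift (A ++ B) ≡ shift A ++ shift B
shift-++ []            B = refl
shift-++ ((g , k) ∷ A) B = cong ((g , suc k) ∷_) (shift-++ A B)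

shift-coDiagram : ∀ t o → shift (coDiagram t o) ≡ coDiagram t (suc o)
shift-coDiagram leaf       o = refl
shift-coDiagram (node x y) o =
  cong ((co , suc o) ∷_) (trans (shift-++ (coDiagram y o) _) (cong₂ _++_ (shift-coDiagram y o) (shift-coDiagram x _)))

shift-coDiagrams : ∀ ts o → shift (coDiagrams ts o) ≡ coDiagrams ts (suc o)
shift-coDiagrams []       o = refl
shift-coDiagrams (t ∷ ts) o = trans (shift-++ (coDiagram t o) _) (cong₂ _++_ (shift-coDiagram t o) (shift-coDiagrams ts _))

shift-prDiagram : ∀ t o → shift (prDiagram t o) ≡ prDiagram t (suc o)
shift-prDiagram leaf       o = refl
shift-prDiagram (node x y) o =
  trans (shift-++ (prDiagram x o) _)
    (cong₂ _++_ (shift-prDiagram x o) (trans (shift-++ (prDiagram y (suc o)) _) (cong (_++ (pr , suc o) ∷ []) (shift-prDiagram y (suc o)))))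

shift-prDiagrams : ∀ ts o → shift (prDiagrams ts o) ≡ prDiagrams ts (suc o)
shift-prDiagrams []       o = refl
shift-prDiagrams (t ∷ ts) o = trans (shift-++ (prDiagram t o) _) (cong₂ _++_ (shift-prDiagram t o) (shift-prDiagrams ts _))

RightOf : ℕ → Diagram → Set
RightOf o []            = ⊤
RightOf o ((g , k) ∷ D) = (o < k) × RightOf o D

RightOf-++ : ∀ o A B → RightOf o A → RightOf o B → RightOf o (A ++ B)
RightOf-++ o []            B _       h = h
RightOf-++ o ((g , k) ∷ A) B (p , a) h = p , RightOf-++ o A B a h

RightOf-coDiagram : ∀ t o o' → o < o' → RightOf o (coDiagram t o')
RightOf-coDiagram leaf       o o' lt = tt
RightOf-coDiagram (node x y) o o' lt =
  lt , RightOf-++ o _ _ (RightOf-coDiagram y o o' lt) (RightOf-coDiagram x o _ (≤-trans lt (m≤m+n o' _)))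

RightOf-coDiagrams : ∀ ts o o' → o < o' → RightOf o (coDiagrams ts o')
RightOf-coDiagrams []       o o' lt = tt
RightOf-coDiagrams (t ∷ ts) o o' lt =
  RightOf-++ o _ _ (RightOf-coDiagram t o o' lt) (RightOf-coDiagrams ts o _ (≤-trans lt (m≤m+n o' _)))

RightOf-prDiagram : ∀ t o o' → o < o' → RightOf o (prDiagram t o')
RightOf-prDiagram leaf       o o' lt = tt
RightOf-prDiagram (node x y) o o' lt =
  RightOf-++ o _ _ (RightOf-prDiagram x o o' lt) (RightOf-++ o _ _ (RightOf-prDiagram y o (suc o') (m<n⇒m<1+n lt)) (lt , tt))

RightOf-prDiagrams : ∀ ts o o' → o < o' → RightOf o (prDiagrams ts o')
RightOf-prDiagrams []       o o' lt = tt
RightOf-prDiagrams (t ∷ ts) o o' lt =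
  RightOf-++ o _ _ (RightOf-prDiagram t o o' lt) (RightOf-prDiagrams ts o (suc o') (m<n⇒m<1+n lt))

pr-slide-up : ∀ o D → RightOf o D → ((pr , o) ∷ D) ≅ (shift D ++ (pr , o) ∷ [])
pr-slide-up o []            _        = ε
pr-slide-up o ((g , k) ∷ D) (lt , h) = ≅-swap-pr o k g D lt ◅◅ ≅-∷ (g , suc k) (pr-slide-up o D h)

pr-slide-up-prDiagram : ∀ t o → ((pr , o) ∷ prDiagram t (suc o)) ≅ (prDiagram t (suc (suc o)) ++ (pr , o) ∷ [])
pr-slide-up-prDiagram t o =
  pr-slide-up o _ (RightOf-prDiagram t o (suc o) ≤-refl) ◅◅ ≅-reflexive (cong (_++ (pr , o) ∷ []) (shift-prDiagram t (suc o)))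

slide-up-coDiagram : ∀ t o j g → o < j → ((g , j) ∷ coDiagram t o) ≅ (coDiagram t o ++ (g , j + size t) ∷ [])
slide-up-coDiagram leaf       o j g lt = ≅-reflexive (cong (λ k → (g , k) ∷ []) (sym (+-identityʳ j)))
slide-up-coDiagram (node x y) o j g lt = begin
  (g , j) ∷ (co , o) ∷ coDiagram y o ++ coDiagram x o'                ≈⟨ ≅-swap-co o j g _ lt ⟨
  (co , o) ∷ (g , suc j) ∷ coDiagram y o ++ coDiagram x o'
    ≈⟨ ≅-∷ (co , o) (≅-congʳ (coDiagram x o') (slide-up-coDiagram y o (suc j) g (m<n⇒m<1+n lt))) ⟩
  (co , o) ∷ (coDiagram y o ++ (g , suc j + size y) ∷ []) ++ coDiagram x o'
    ≡⟨ cong ((co , o) ∷_) (++-assoc (coDiagram y o) _ (coDiagram x o')) ⟩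
  (co , o) ∷ coDiagram y o ++ (g , suc j + size y) ∷ coDiagram x o'
    ≈⟨ ≅-congˡ ((co , o) ∷ coDiagram y o) (slide-up-coDiagram x o' (suc j + size y) g o'<) ⟩
  (co , o) ∷ coDiagram y o ++ (coDiagram x o' ++ (g , suc j + size y + size x) ∷ [])
    ≡⟨ cong ((co , o) ∷_) (trans (sym (++-assoc (coDiagram y o) (coDiagram x o') _))
          (cong (λ k → (coDiagram y o ++ coDiagram x o') ++ (g , k) ∷ []) (index j (size y) (size x)))) ⟩
  ((co , o) ∷ coDiagram y o ++ coDiagram x o') ++ (g , j + size (node x y)) ∷ [] ∎
  where
    open ≅-Reasoning
    o' = o + suc (size y)
    o'< : o' < suc j + size y
    o'< = subst (_< suc j + size y) (sym (+-suc o (size y))) (s≤s (+-monoˡ-< (size y) lt))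
    index : ∀ j y x → suc j + y + x ≡ j + suc (x + y)
    index = solve-∀

Spans : ℕ → Diagram → ℕ → Set
Spans w []             v = w ≡ v
Spans w ((co , i) ∷ D) v = i < w × Spans (suc w) D v
Spans w ((pr , i) ∷ D) v = suc i < w × Spans (pred w) D v

Valid→Spans : ∀ w D → Valid w D → Spans w D 1
Valid→Spans w []             v       = v
Valid→Spans w ((co , i) ∷ D) (a , v) = a , Valid→Spans _ D v
Valid→Spans w ((pr , i) ∷ D) (a , v) = a , Valid→Spans _ D v

Spans→Valid : ∀ w D → Spans w D 1 → Valid w D
Spans→Valid w []             v       = v
Spans→Valid w ((co , i) ∷ D) (a , v) = a , Spans→Valid _ D v
Spans→Valid w ((pr , i) ∷ D) (a , v) = a , Spans→Valid _ D v

Spans-++⁻ : ∀ w A B v → Spans w (A ++ B) v → Σ ℕ λ u → Spans w A u × Spans u B v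
Spans-++⁻ w []             B v h       = w , refl , h
Spans-++⁻ w ((co , i) ∷ A) B v (a , h) = let (u , h₁ , h₂) = Spans-++⁻ (suc w) A B v h in u , (a , h₁) , h₂
Spans-++⁻ w ((pr , i) ∷ A) B v (a , h) = let (u , h₁ , h₂) = Spans-++⁻ (pred w) A B v h in u , (a , h₁) , h₂

Spans-++⁺ : ∀ w A B u v → Spans w A u → Spans u B v → Spans w (A ++ B) v
Spans-++⁺ w []             B u v refl     h₂ = h₂
Spans-++⁺ w ((co , i) ∷ A) B u v (a , h₁) h₂ = a , Spans-++⁺ (suc w) A B u v h₁ h₂
Spans-++⁺ w ((pr , i) ∷ A) B u v (a , h₁) h₂ = a , Spans-++⁺ (pred w) A B u v h₁ h₂

Spans-resp : ∀ {w w' D v v'} → w ≡ w' → v ≡ v' → Spans w D v → Spans w' D v'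
Spans-resp refl refl h = h

length-sprout : ∀ i xs → i < length xs → length (sprout i xs) ≡ suc (length xs)
length-sprout zero    (x ∷ xs) _        = refl
length-sprout (suc i) (x ∷ xs) (s≤s lt) = cong suc (length-sprout i xs lt)

length-combine : ∀ c i xs → suc i < length xs → length (combine c i xs) ≡ pred (length xs)
length-combine c zero    (a ∷ [])     (s≤s ())
length-combine c zero    (a ∷ b ∷ xs) _        = refl
length-combine c (suc i) (a ∷ b ∷ xs) (s≤s lt) = cong suc (length-combine c i (b ∷ xs) lt)

length-evalUp : ∀ w D u xs → Spans w D u → length xs ≡ w → length (evalUp D xs) ≡ u
length-evalUp w []             u xs e       l = trans l e
length-evalUp w ((co , i) ∷ D) u xs (a , h) l =
  length-evalUp (suc w) D u (sprout i xs) h (trans (length-sprout i xs (subst (i <_) (sym l) a)) (cong suc l))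
length-evalUp w ((pr , i) ∷ D) u xs (a , h) l =
  length-evalUp (pred w) D u (combine node i xs) h (trans (length-combine node i xs (subst (suc i <_) (sym l) a)) (cong pred l))

OnlyOf : Gen → Diagram → Set
OnlyOf g = All (λ l → proj₁ l ≡ g)

OnlyOf-coDiagram : ∀ t o → OnlyOf co (coDiagram t o)
OnlyOf-coDiagram leaf       o = []
OnlyOf-coDiagram (node x y) o = refl ∷ ++⁺ (OnlyOf-coDiagram y o) (OnlyOf-coDiagram x _)

OnlyOf-prDiagram : ∀ t o → OnlyOf pr (prDiagram t o)
OnlyOf-prDiagram leaf       o = []
OnlyOf-prDiagram (node x y) o = ++⁺ (OnlyOf-prDiagram x o) (++⁺ (OnlyOf-prDiagram y (suc o)) (refl ∷ []))

Spans-coDiagram : ∀ t o w → o < w → Spans w (coDiagram t o) (w + size t)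
Spans-coDiagram leaf       o w lt = sym (+-identityʳ w)
Spans-coDiagram (node x y) o w lt =
  lt , Spans-++⁺ (suc w) (coDiagram y o) _ (suc w + size y) _ (Spans-coDiagram y o (suc w) (m<n⇒m<1+n lt))
         (Spans-resp refl (width w (size y) (size x))
           (Spans-coDiagram x (o + suc (size y)) (suc w + size y)
             (subst (_< suc w + size y) (sym (+-suc o (size y))) (s≤s (+-monoˡ-< (size y) lt)))))
  where
    width : ∀ w y x → suc w + y + x ≡ w + suc (x + y)
    width = solve-∀

Spans-prDiagram : ∀ t o m → Spans (suc (o + size t + m)) (prDiagram t o) (suc (o + m))
Spans-prDiagram leaf       o m = cong (λ k → suc (k + m)) (+-identityʳ o)
Spans-prDiagram (node x y) o m =
  Spans-++⁺ _ (prDiagram x o) _ (suc (o + suc (size y + m))) _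
    (Spans-resp (cong suc (sym (width₁ o (size x) (size y) m))) refl (Spans-prDiagram x o (suc (size y + m))))
    (Spans-++⁺ _ (prDiagram y (suc o)) _ (suc (suc o + m)) _
      (Spans-resp (cong suc (sym (width₂ o (size y) m))) refl (Spans-prDiagram y (suc o) m))
      (s≤s (s≤s (m≤m+n o m)) , refl))
  where
    width₁ : ∀ o x y m → o + suc (x + y) + m ≡ o + x + suc (y + m)
    width₁ = solve-∀
    width₂ : ∀ o y m → o + suc (y + m) ≡ suc o + y + m
    width₂ = solve-∀

Spans-prDiagram₀ : ∀ p → Spans (suc (size p)) (prDiagram p 0) 1
Spans-prDiagram₀ p = Spans-resp (cong suc (+-identityʳ (size p))) refl (Spans-prDiagram p 0 0)

leaves : ℕ → List Tree
leaves n = replicate n leaf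

leaves-+ : ∀ a b → leaves (a + b) ≡ leaves a ++ leaves b
leaves-+ zero    b = refl
leaves-+ (suc a) b = cong (leaf ∷_) (leaves-+ a b)

sprout-leaves : ∀ i w → i < w → sprout i (leaves w) ≡ leaves (suc w)
sprout-leaves zero    (suc w) _        = refl
sprout-leaves (suc i) (suc w) (s≤s lt) = cong (leaf ∷_) (sprout-leaves i w lt)

evalUp-coproducts : ∀ D w u → OnlyOf co D → Spans w D u → evalUp D (leaves w) ≡ leaves u
evalUp-coproducts []             w u _          e       = cong leaves e
evalUp-coproducts ((co , i) ∷ D) w u (_ ∷ only) (a , h) =
  trans (cong (evalUp D) (sprout-leaves i w a)) (evalUp-coproducts D (suc w) u only h)

evalDown-products : ∀ D w u → OnlyOf pr D → Spans w D u → evalDown D (leaves u) ≡ leaves w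
evalDown-products []                   w       u _          e       = cong leaves (sym e)
evalDown-products ((pr , i) ∷ D) (suc w) u (_ ∷ only) (a , h) =
  trans (cong (sprout i) (evalDown-products D w u only h)) (sprout-leaves i w (≤-pred a))

combine-at : ∀ c xs o a b ys → length xs ≡ o → combine c o (xs ++ a ∷ b ∷ ys) ≡ xs ++ c a b ∷ ys
combine-at c []       zero    a b ys _ = refl
combine-at c (x ∷ xs) (suc o) a b ys e = cong (x ∷_) (combine-at c xs o a b ys (suc-injective e))

evalDown-coDiagram : ∀ t o xs ys → length xs ≡ o → evalDown (coDiagram t o) (xs ++ leaves (suc (size t)) ++ ys) ≡ xs ++ t ∷ ys
evalDown-coDiagram leaf       o xs ys e = refl
evalDown-coDiagram (node x y) o xs ys e = begin
  combine flipNode o (evalDown (coDiagram y o ++ coDiagram x o') (xs ++ leaves (suc (size (node x y))) ++ ys))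
    ≡⟨ cong (combine flipNode o) (evalDown-++ (coDiagram y o) (coDiagram x o') _) ⟩
  combine flipNode o (evalDown (coDiagram y o) (evalDown (coDiagram x o') (xs ++ leaves (suc (size (node x y))) ++ ys)))
    ≡⟨ cong (λ z → combine flipNode o (evalDown (coDiagram y o) (evalDown (coDiagram x o') z))) split-leaves ⟩
  combine flipNode o (evalDown (coDiagram y o) (evalDown (coDiagram x o') ((xs ++ leaves (suc (size y))) ++ leaves (suc (size x)) ++ ys)))
    ≡⟨ cong (λ z → combine flipNode o (evalDown (coDiagram y o) z))
            (trans (evalDown-coDiagram x o' (xs ++ leaves (suc (size y))) ys length-o') (++-assoc xs _ _)) ⟩
  combine flipNode o (evalDown (coDiagram y o) (xs ++ leaves (suc (size y)) ++ x ∷ ys))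
    ≡⟨ cong (combine flipNode o) (evalDown-coDiagram y o xs (x ∷ ys) e) ⟩
  combine flipNode o (xs ++ y ∷ x ∷ ys)  ≡⟨ combine-at flipNode xs o y x ys e ⟩
  xs ++ node x y ∷ ys                   ∎
  where
    open ≡-Reasoning
    o' = o + suc (size y)
    length-o' : length (xs ++ leaves (suc (size y))) ≡ o'
    length-o' = trans (length-++ xs) (cong₂ _+_ e (length-replicate (suc (size y))))
    count : ∀ x y → suc (suc (x + y)) ≡ suc y + suc x
    count = solve-∀
    split-leaves : xs ++ leaves (suc (size (node x y))) ++ ys ≡ (xs ++ leaves (suc (size y))) ++ leaves (suc (size x)) ++ ys
    split-leaves = trans (cong (λ k → xs ++ leaves k ++ ys) (count (size x) (size y)))
      (trans (cong (λ l → xs ++ l ++ ys) (leaves-+ (suc (size y)) (suc (size x))))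
        (trans (cong (xs ++_) (++-assoc (leaves (suc (size y))) _ ys)) (sym (++-assoc xs _ _))))

evalUp-prDiagram : ∀ t o xs ys → length xs ≡ o → evalUp (prDiagram t o) (xs ++ leaves (suc (size t)) ++ ys) ≡ xs ++ t ∷ ys
evalUp-prDiagram leaf       o xs ys e = refl
evalUp-prDiagram (node x y) o xs ys e = begin
  evalUp (prDiagram x o ++ prDiagram y (suc o) ++ (pr , o) ∷ []) (xs ++ leaves (suc (size (node x y))) ++ ys)
    ≡⟨ evalUp-++ (prDiagram x o) _ _ ⟩
  evalUp (prDiagram y (suc o) ++ (pr , o) ∷ []) (evalUp (prDiagram x o) (xs ++ leaves (suc (size (node x y))) ++ ys))
    ≡⟨ evalUp-++ (prDiagram y (suc o)) _ _ ⟩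
  combine node o (evalUp (prDiagram y (suc o)) (evalUp (prDiagram x o) (xs ++ leaves (suc (size (node x y))) ++ ys)))
    ≡⟨ cong (λ z → combine node o (evalUp (prDiagram y (suc o)) (evalUp (prDiagram x o) z))) split-leaves ⟩
  combine node o (evalUp (prDiagram y (suc o)) (evalUp (prDiagram x o) (xs ++ leaves (suc (size x)) ++ leaves (suc (size y)) ++ ys)))
    ≡⟨ cong (λ z → combine node o (evalUp (prDiagram y (suc o)) z))
            (trans (evalUp-prDiagram x o xs _ e) (sym (++-assoc xs (x ∷ []) _))) ⟩
  combine node o (evalUp (prDiagram y (suc o)) ((xs ++ x ∷ []) ++ leaves (suc (size y)) ++ ys))
    ≡⟨ cong (combine node o) (trans (evalUp-prDiagram y (suc o) (xs ++ x ∷ []) ys length-x) (++-assoc xs (x ∷ []) _)) ⟩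
  combine node o (xs ++ x ∷ y ∷ ys)  ≡⟨ combine-at node xs o x y ys e ⟩
  xs ++ node x y ∷ ys               ∎
  where
    open ≡-Reasoning
    length-x : length (xs ++ x ∷ []) ≡ suc o
    length-x = trans (length-++ xs) (trans (+-comm (length xs) 1) (cong suc e))
    count : ∀ x y → suc (suc (x + y)) ≡ suc x + suc y
    count = solve-∀
    split-leaves : xs ++ leaves (suc (size (node x y))) ++ ys ≡ xs ++ leaves (suc (size x)) ++ leaves (suc (size y)) ++ ys
    split-leaves = cong (xs ++_) (trans (cong (λ k → leaves k ++ ys) (count (size x) (size y)))
      (trans (cong (_++ ys) (leaves-+ (suc (size x)) (suc (size y)))) (++-assoc (leaves (suc (size x))) _ ys)))

coproductTree-canonical : ∀ c p → size c ≡ size p → coproductTree (canonical c p) ≡ c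
coproductTree-canonical c p e = cong headTree (begin
  evalDown (coDiagram c 0 ++ prDiagram p 0) (leaf ∷ [])        ≡⟨ evalDown-++ (coDiagram c 0) (prDiagram p 0) (leaf ∷ []) ⟩
  evalDown (coDiagram c 0) (evalDown (prDiagram p 0) (leaves 1))
    ≡⟨ cong (evalDown (coDiagram c 0)) (evalDown-products (prDiagram p 0) (suc (size p)) 1 (OnlyOf-prDiagram p 0) (Spans-prDiagram₀ p)) ⟩
  evalDown (coDiagram c 0) (leaves (suc (size p)))             ≡⟨ cong (λ k → evalDown (coDiagram c 0) (leaves (suc k))) e ⟨
  evalDown (coDiagram c 0) (leaves (suc (size c)))             ≡⟨ cong (evalDown (coDiagram c 0)) (++-identityʳ _) ⟨
  evalDown (coDiagram c 0) ([] ++ leaves (suc (size c)) ++ [])  ≡⟨ evalDown-coDiagram c 0 [] [] refl ⟩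
  c ∷ []                                                       ∎)
  where open ≡-Reasoning

productTree-canonical : ∀ c p → size c ≡ size p → productTree (canonical c p) ≡ p
productTree-canonical c p e = cong headTree (begin
  evalUp (coDiagram c 0 ++ prDiagram p 0) (leaf ∷ [])        ≡⟨ evalUp-++ (coDiagram c 0) (prDiagram p 0) (leaf ∷ []) ⟩
  evalUp (prDiagram p 0) (evalUp (coDiagram c 0) (leaves 1))
    ≡⟨ cong (evalUp (prDiagram p 0)) (evalUp-coproducts (coDiagram c 0) 1 (suc (size c)) (OnlyOf-coDiagram c 0) (Spans-coDiagram c 0 1 (s≤s z≤n))) ⟩
  evalUp (prDiagram p 0) (leaves (suc (size c)))             ≡⟨ cong (λ k → evalUp (prDiagram p 0) (leaves (suc k))) e ⟩
  evalUp (prDiagram p 0) (leaves (suc (size p)))             ≡⟨ cong (evalUp (prDiagram p 0)) (++-identityʳ _) ⟨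
  evalUp (prDiagram p 0) ([] ++ leaves (suc (size p)) ++ [])  ≡⟨ evalUp-prDiagram p 0 [] [] refl ⟩
  p ∷ []                                                     ∎)
  where open ≡-Reasoning

#co-++ : ∀ A B → #co (A ++ B) ≡ #co A + #co B
#co-++ []             B = refl
#co-++ ((co , _) ∷ A) B = cong suc (#co-++ A B)
#co-++ ((pr , _) ∷ A) B = #co-++ A B

#pr-++ : ∀ A B → #pr (A ++ B) ≡ #pr A + #pr B
#pr-++ []             B = refl
#pr-++ ((co , _) ∷ A) B = #pr-++ A B
#pr-++ ((pr , _) ∷ A) B = cong suc (#pr-++ A B)

#pr-coproducts : ∀ D → OnlyOf co D → #pr D ≡ 0
#pr-coproducts []             []         = refl
#pr-coproducts ((co , _) ∷ D) (_ ∷ only) = #pr-coproducts D only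

#co-products : ∀ D → OnlyOf pr D → #co D ≡ 0
#co-products []             []         = refl
#co-products ((pr , _) ∷ D) (_ ∷ only) = #co-products D only

#co-coDiagram : ∀ t o → #co (coDiagram t o) ≡ size t
#co-coDiagram leaf       o = refl
#co-coDiagram (node x y) o = cong suc (trans (#co-++ (coDiagram y o) _)
  (trans (cong₂ _+_ (#co-coDiagram y o) (#co-coDiagram x _)) (+-comm (size y) (size x))))

#pr-prDiagram : ∀ t o → #pr (prDiagram t o) ≡ size t
#pr-prDiagram leaf       o = refl
#pr-prDiagram (node x y) o =
  trans (#pr-++ (prDiagram x o) _)
    (trans (cong₂ _+_ (#pr-prDiagram x o)
                      (trans (#pr-++ (prDiagram y (suc o)) _) (trans (cong (_+ 1) (#pr-prDiagram y (suc o))) (+-comm (size y) 1))))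
           (+-suc (size x) (size y)))

flagsAfter : List Bool → Diagram → List Bool
flagsAfter ws []             = ws
flagsAfter ws ((co , i) ∷ D) = flagsAfter (splitCo ws i) D
flagsAfter ws ((pr , i) ∷ D) = flagsAfter (mergePr ws i) D

NoPC-++ : ∀ ws A B → NoPC ws A → NoPC (flagsAfter ws A) B → NoPC ws (A ++ B)
NoPC-++ ws []             B _        h = h
NoPC-++ ws ((co , i) ∷ A) B (e , ha) h = e , NoPC-++ (splitCo ws i) A B ha h
NoPC-++ ws ((pr , i) ∷ A) B ha       h = NoPC-++ (mergePr ws i) A B ha h

NoPC-products : ∀ D ws → OnlyOf pr D → NoPC ws D
NoPC-products []             ws []         = tt
NoPC-products ((pr , i) ∷ D) ws (_ ∷ only) = NoPC-products D (mergePr ws i) only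

lookupB-false : ∀ ws i → All (_≡ false) ws → lookupB ws i ≡ false
lookupB-false []       i       []       = refl
lookupB-false (b ∷ bs) zero    (e ∷ _)  = e
lookupB-false (b ∷ bs) (suc i) (_ ∷ es) = lookupB-false bs i es

splitCo-false : ∀ ws i → All (_≡ false) ws → All (_≡ false) (splitCo ws i)
splitCo-false []       i       []       = []
splitCo-false (b ∷ bs) zero    (_ ∷ es) = refl ∷ refl ∷ es
splitCo-false (b ∷ bs) (suc i) (e ∷ es) = e ∷ splitCo-false bs i es

NoPC-coproducts : ∀ D ws → OnlyOf co D → All (_≡ false) ws → NoPC ws D
NoPC-coproducts []             ws []         _  = tt
NoPC-coproducts ((co , i) ∷ D) ws (_ ∷ only) es = lookupB-false ws i es , NoPC-coproducts D (splitCo ws i) only (splitCo-false ws i es)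

canonical-IsQ : ∀ n c p → size c ≡ n → size p ≡ n → IsQ n (canonical c p)
canonical-IsQ n c p ec ep =
  Spans→Valid 1 (canonical c p)
    (Spans-++⁺ 1 (coDiagram c 0) (prDiagram p 0) (suc (size c)) 1 (Spans-coDiagram c 0 1 (s≤s z≤n))
      (Spans-resp (cong suc (trans ep (sym ec))) refl (Spans-prDiagram₀ p))) ,
  trans (#co-++ (coDiagram c 0) _)
    (trans (cong₂ _+_ (#co-coDiagram c 0) (#co-products (prDiagram p 0) (OnlyOf-prDiagram p 0))) (trans (+-identityʳ _) ec)) ,
  trans (#pr-++ (coDiagram c 0) _) (trans (cong₂ _+_ (#pr-coproducts (coDiagram c 0) (OnlyOf-coDiagram c 0)) (#pr-prDiagram p 0)) ep) ,
  NoPC-++ (false ∷ []) (coDiagram c 0) _ (NoPC-coproducts (coDiagram c 0) _ (OnlyOf-coDiagram c 0) (refl ∷ []))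
    (NoPC-products (prDiagram p 0) _ (OnlyOf-prDiagram p 0))

totalSize : List Tree → ℕ
totalSize []       = 0
totalSize (t ∷ ts) = size t + totalSize ts

lookupTree : List Tree → ℕ → Tree
lookupTree []       _       = leaf
lookupTree (t ∷ _)  zero    = t
lookupTree (_ ∷ ts) (suc i) = lookupTree ts i

-- the wire of the root of the i-th tree in coDiagrams ts o
rootWire : List Tree → ℕ → ℕ → ℕ
rootWire []       o _       = o
rootWire (t ∷ ts) o zero    = o
rootWire (t ∷ ts) o (suc i) = rootWire ts (o + suc (size t)) i

rootWire-≤ : ∀ ts o i → rootWire ts o i ≤ o + i + totalSize ts
rootWire-≤ []       o i       = ≤-trans (m≤m+n o i) (m≤m+n _ 0)
rootWire-≤ (t ∷ ts) o zero    = ≤-trans (m≤m+n o 0) (m≤m+n _ _)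
rootWire-≤ (t ∷ ts) o (suc i) = ≤-trans (rootWire-≤ ts (o + suc (size t)) i) (≤-reflexive (shuffle o (size t) i (totalSize ts)))
  where
    shuffle : ∀ o t i s → o + suc t + i + s ≡ o + suc i + (t + s)
    shuffle = solve-∀

slide-up-first-coDiagram : ∀ g t ts o i →
  ((g , o + suc i) ∷ coDiagrams (t ∷ ts) o) ≅ (coDiagram t o ++ (g , o + suc (size t) + i) ∷ coDiagrams ts (o + suc (size t)))
slide-up-first-coDiagram g t ts o i = begin
  (g , o + suc i) ∷ coDiagram t o ++ coDiagrams ts o₂
    ≈⟨ ≅-congʳ (coDiagrams ts o₂) (slide-up-coDiagram t o (o + suc i) g (m<m+n o (s≤s z≤n))) ⟩
  (coDiagram t o ++ (g , o + suc i + size t) ∷ []) ++ coDiagrams ts o₂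
    ≡⟨ trans (++-assoc (coDiagram t o) _ _) (cong (λ k → coDiagram t o ++ (g , k) ∷ coDiagrams ts o₂) (shuffle o (size t) i)) ⟩
  coDiagram t o ++ (g , o₂ + i) ∷ coDiagrams ts o₂ ∎
  where
    open ≅-Reasoning
    o₂ = o + suc (size t)
    shuffle : ∀ o t i → o + suc i + t ≡ o + suc t + i
    shuffle = solve-∀

co-absorb : ∀ ts o i → suc i < length ts → ((co , o + i) ∷ coDiagrams ts o) ≅ coDiagrams (combine flipNode i ts) o
co-absorb (a ∷ b ∷ ts) o zero _ = ≅-reflexive (trans
  (cong₂ (λ p q → (co , p) ∷ coDiagram a o ++ coDiagram b (o + suc (size a)) ++ coDiagrams ts q)
         (+-identityʳ o) (shuffle o (size a) (size b)))
  (cong ((co , o) ∷_) (sym (++-assoc (coDiagram a o) (coDiagram b _) _))))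
  where
    shuffle : ∀ o a b → o + suc a + suc b ≡ o + suc (suc (b + a))
    shuffle = solve-∀
co-absorb (t ∷ ts) o (suc i) (s≤s lt) =
  slide-up-first-coDiagram co t ts o i ◅◅ ≅-congˡ (coDiagram t o) (co-absorb ts (o + suc (size t)) i lt)

pr-pass : ∀ ts o i → lookupTree ts i ≡ leaf → i < length ts →
          ((pr , o + i) ∷ coDiagrams ts o) ≅ (coDiagrams (sprout i ts) o ++ (pr , rootWire ts o i) ∷ [])
pr-pass (leaf ∷ ts) o zero _ _ = begin
  (pr , o + 0) ∷ coDiagrams ts (o + 1)          ≡⟨ cong (λ k → (pr , k) ∷ coDiagrams ts (o + 1)) (+-identityʳ o) ⟩
  (pr , o) ∷ coDiagrams ts (o + 1)              ≈⟨ pr-slide-up o _ (RightOf-coDiagrams ts o (o + 1) (subst (o <_) (+-comm 1 o) ≤-refl)) ⟩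
  shift (coDiagrams ts (o + 1)) ++ (pr , o) ∷ [] ≡⟨ cong (_++ (pr , o) ∷ []) (trans (shift-coDiagrams ts (o + 1)) (cong (coDiagrams ts) (+-comm 1 (o + 1)))) ⟩
  coDiagrams ts (o + 1 + 1) ++ (pr , o) ∷ []    ∎
  where open ≅-Reasoning
pr-pass (node _ _ ∷ ts) o zero () _
pr-pass (t ∷ ts) o (suc i) isLeaf (s≤s lt) =
  slide-up-first-coDiagram pr t ts o i ◅◅ (≅-congˡ (coDiagram t o) (pr-pass ts (o + suc (size t)) i isLeaf lt)
    ◅◅ ≅-reflexive (sym (++-assoc (coDiagram t o) _ _)))

length-splitCo : ∀ ws i → i < length ws → length (splitCo ws i) ≡ suc (length ws)
length-splitCo (b ∷ bs) zero    _        = refl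
length-splitCo (b ∷ bs) (suc i) (s≤s lt) = cong suc (length-splitCo bs i lt)

length-mergePr : ∀ ws i → suc i < length ws → length (mergePr ws i) ≡ pred (length ws)
length-mergePr (b ∷ [])     zero    (s≤s ())
length-mergePr (b ∷ c ∷ bs) zero    _        = refl
length-mergePr (b ∷ c ∷ bs) (suc i) (s≤s lt) = cong suc (length-mergePr (c ∷ bs) i lt)

lookupB-mergePr : ∀ ws i → suc i < length ws → lookupB (mergePr ws i) i ≡ true
lookupB-mergePr (b ∷ [])     zero    (s≤s ())
lookupB-mergePr (b ∷ c ∷ bs) zero    _        = refl
lookupB-mergePr (b ∷ c ∷ bs) (suc i) (s≤s lt) = lookupB-mergePr (c ∷ bs) i lt

-- Below a product output no coproduct can sit, so its tree in the downward evaluation is a leaf.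
LeafOnFlagged : List Bool → List Tree → Set
LeafOnFlagged = Pointwise (λ b t → b ≡ true → t ≡ leaf)

lookup-leafOnFlagged : ∀ {bs ts} → LeafOnFlagged bs ts → ∀ i → lookupB bs i ≡ true → lookupTree ts i ≡ leaf
lookup-leafOnFlagged []      i       _ = refl
lookup-leafOnFlagged (h ∷ _) zero    e = h e
lookup-leafOnFlagged (_ ∷ g) (suc i) e = lookup-leafOnFlagged g i e

leafOnFlagged-co : ∀ ws i xs → LeafOnFlagged (splitCo ws i) xs → lookupB ws i ≡ false →
                   LeafOnFlagged ws (combine flipNode i xs)
leafOnFlagged-co []       i       []       []             _ = []
leafOnFlagged-co (b ∷ bs) zero    (x ∷ y ∷ xs) (_ ∷ _ ∷ g) e = (λ b≡true → ⊥-elim (true≢false (trans (sym b≡true) e))) ∷ g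
  where
    true≢false : true ≢ false
    true≢false ()
leafOnFlagged-co (b ∷ bs) (suc i) (x ∷ xs) (h ∷ g) e = h ∷ leafOnFlagged-co bs i xs g e

leafOnFlagged-pr : ∀ ws i xs → suc i < length ws → LeafOnFlagged (mergePr ws i) xs → LeafOnFlagged ws (sprout i xs)
leafOnFlagged-pr (b ∷ [])     zero    xs       (s≤s ()) _
leafOnFlagged-pr (b ∷ c ∷ bs) zero    (x ∷ xs) _        (h ∷ g) = (λ _ → h refl) ∷ (λ _ → refl) ∷ g
leafOnFlagged-pr (b ∷ c ∷ bs) (suc i) (x ∷ xs) (s≤s lt) (h ∷ g) = h ∷ leafOnFlagged-pr (c ∷ bs) i xs lt g

evalDown-leafOnFlagged : ∀ D w ws → Valid w D → NoPC ws D → length ws ≡ w → LeafOnFlagged ws (evalDown D (leaf ∷ []))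
evalDown-leafOnFlagged [] w (b ∷ [])      v _ _ = (λ _ → refl) ∷ []
evalDown-leafOnFlagged [] w []            v _ l = ⊥-elim (0≢1+n (trans l v))
evalDown-leafOnFlagged [] w (_ ∷ _ ∷ _)   v _ l = ⊥-elim (0≢1+n (suc-injective (trans (sym v) (sym l))))
evalDown-leafOnFlagged ((co , i) ∷ D) w ws (lt , v) (f , np) l =
  leafOnFlagged-co ws i _
    (evalDown-leafOnFlagged D (suc w) (splitCo ws i) v np (trans (length-splitCo ws i (subst (i <_) (sym l) lt)) (cong suc l))) f
evalDown-leafOnFlagged ((pr , i) ∷ D) w ws (lt , v) np l =
  leafOnFlagged-pr ws i _ (subst (suc i <_) (sym l) lt)
    (evalDown-leafOnFlagged D (pred w) (mergePr ws i) v np (trans (length-mergePr ws i (subst (suc i <_) (sym l) lt)) (cong pred l)))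

totalSize-sprout : ∀ i xs → totalSize (sprout i xs) ≡ totalSize xs
totalSize-sprout i       []       = refl
totalSize-sprout zero    (x ∷ xs) = refl
totalSize-sprout (suc i) (x ∷ xs) = cong (size x +_) (totalSize-sprout i xs)

totalSize-combine : ∀ c → (∀ a b → size (c a b) ≡ suc (size a + size b)) →
                    ∀ i xs → suc i < length xs → totalSize (combine c i xs) ≡ suc (totalSize xs)
totalSize-combine c size-c zero    (a ∷ [])     (s≤s ())
totalSize-combine c size-c zero    (a ∷ b ∷ xs) _        =
  trans (cong (_+ totalSize xs) (size-c a b)) (cong suc (+-assoc (size a) (size b) (totalSize xs)))
totalSize-combine c size-c (suc i) (a ∷ b ∷ xs) (s≤s lt) =
  trans (cong (size a +_) (totalSize-combine c size-c i (b ∷ xs) lt)) (+-suc (size a) _)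

size-node : ∀ a b → size (node a b) ≡ suc (size a + size b)
size-node a b = refl

size-flipNode : ∀ a b → size (flipNode a b) ≡ suc (size a + size b)
size-flipNode a b = cong suc (+-comm (size b) (size a))

length-evalDown : ∀ D w ws → Valid w D → NoPC ws D → length ws ≡ w → length (evalDown D (leaf ∷ [])) ≡ w
length-evalDown D w ws v np l = trans (sym (Pointwise-length (evalDown-leafOnFlagged D w ws v np l))) l

totalSize-evalDown : ∀ D w ws → Valid w D → NoPC ws D → length ws ≡ w → totalSize (evalDown D (leaf ∷ [])) ≡ #co D
totalSize-evalDown []             w ws v        np       l = refl
totalSize-evalDown ((co , i) ∷ D) w ws (lt , v) (_ , np) l =
  trans (totalSize-combine flipNode size-flipNode i (evalDown D (leaf ∷ []))
           (subst (suc i <_) (sym (length-evalDown D (suc w) (splitCo ws i) v np l')) (s≤s lt)))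
        (cong suc (totalSize-evalDown D (suc w) (splitCo ws i) v np l'))
  where l' = trans (length-splitCo ws i (subst (i <_) (sym l) lt)) (cong suc l)
totalSize-evalDown ((pr , i) ∷ D) w ws (lt , v) np l =
  trans (totalSize-sprout i (evalDown D (leaf ∷ [])))
        (totalSize-evalDown D (pred w) (mergePr ws i) v np (trans (length-mergePr ws i (subst (suc i <_) (sym l) lt)) (cong pred l)))

totalSize-evalUp : ∀ D w xs → Spans w D 1 → length xs ≡ w → totalSize (evalUp D xs) ≡ totalSize xs + #pr D
totalSize-evalUp []             w xs _       _ = sym (+-identityʳ _)
totalSize-evalUp ((co , i) ∷ D) w xs (a , h) l =
  trans (totalSize-evalUp D (suc w) (sprout i xs) h (trans (length-sprout i xs (subst (i <_) (sym l) a)) (cong suc l)))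
        (cong (_+ #pr D) (totalSize-sprout i xs))
totalSize-evalUp ((pr , i) ∷ D) w xs (a , h) l =
  trans (totalSize-evalUp D (pred w) (combine node i xs) h (trans (length-combine node i xs (subst (suc i <_) (sym l) a)) (cong pred l)))
        (trans (cong (_+ #pr D) (totalSize-combine node size-node i xs (subst (suc i <_) (sym l) a))) (sym (+-suc _ _)))

singleton : ∀ (xs : List Tree) → length xs ≡ 1 → xs ≡ headTree xs ∷ []
singleton (x ∷ []) _ = refl

totalSize-singleton : ∀ (xs : List Tree) → length xs ≡ 1 → totalSize xs ≡ size (headTree xs)
totalSize-singleton (x ∷ []) _ = +-identityʳ (size x)

CoproductsFirst : ℕ → Diagram → Set
CoproductsFirst w D = Σ Diagram λ P → OnlyOf pr P × Valid (w + totalSize (evalDown D (leaf ∷ []))) P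
                                    × (D ≅ (coDiagrams (evalDown D (leaf ∷ [])) 0 ++ P))

-- Induction from the bottom vertex: a coproduct merges two adjacent coproduct trees, while a
-- product sits on a wire whose coproduct tree is a leaf and so slides up past all of them.
coproducts-first : ∀ D w ws → Valid w D → NoPC ws D → length ws ≡ w → CoproductsFirst w D
coproducts-first [] w ws v np l = [] , [] , trans (+-identityʳ w) v , ε
coproducts-first ((co , i) ∷ D) w ws (lt , v) (_ , np) l =
  let (P , only , valid , iso) = coproducts-first D (suc w) (splitCo ws i) v np l'
  in P , only , subst (λ k → Valid k P) width valid , (≅-∷ (co , i) iso ◅◅ ≅-congʳ P (co-absorb cs 0 i i+1<))
  where
    l' = trans (length-splitCo ws i (subst (i <_) (sym l) lt)) (cong suc l)
    cs = evalDown D (leaf ∷ [])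
    i+1< : suc i < length cs
    i+1< = subst (suc i <_) (sym (length-evalDown D (suc w) (splitCo ws i) v np l')) (s≤s lt)
    width : suc w + totalSize cs ≡ w + totalSize (combine flipNode i cs)
    width = trans (sym (+-suc w _)) (cong (w +_) (sym (totalSize-combine flipNode size-flipNode i cs i+1<)))
coproducts-first ((pr , i) ∷ D) (suc w) ws (i+1<w@(s≤s i<w) , v) np l =
  let (P , only , valid , iso) = coproducts-first D w (mergePr ws i) v np l'
  in (pr , rootWire cs 0 i) ∷ P , refl ∷ only ,
     (bound , subst (λ k → Valid (w + k) P) (sym (totalSize-sprout i cs)) valid) ,
     (≅-∷ (pr , i) iso ◅◅ (≅-congʳ P (pr-pass cs 0 i isLeaf i<) ◅◅ ≅-reflexive (++-assoc (coDiagrams (sprout i cs) 0) _ P)))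
  where
    l' = trans (length-mergePr ws i (subst (suc i <_) (sym l) i+1<w)) (cong pred l)
    cs = evalDown D (leaf ∷ [])
    i< : i < length cs
    i< = subst (i <_) (sym (length-evalDown D w (mergePr ws i) v np l')) i<w
    isLeaf : lookupTree cs i ≡ leaf
    isLeaf = lookup-leafOnFlagged (evalDown-leafOnFlagged D w (mergePr ws i) v np l') i
               (lookupB-mergePr ws i (subst (suc i <_) (sym l) i+1<w))
    bound : suc (rootWire cs 0 i) < suc w + totalSize (sprout i cs)
    bound = subst (λ k → suc (rootWire cs 0 i) < suc w + k) (sym (totalSize-sprout i cs))
      (≤-trans (s≤s (s≤s (rootWire-≤ cs 0 i))) (+-monoˡ-≤ (totalSize cs) i+1<w))

prDiagrams-combine : ∀ ts o i → suc i < length ts → (prDiagrams ts o ++ (pr , o + i) ∷ []) ≅ prDiagrams (combine node i ts) o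
prDiagrams-combine (a ∷ [])     o zero (s≤s ())
prDiagrams-combine (a ∷ b ∷ ts) o zero _ = begin
  (prDiagram a o ++ prDiagram b (suc o) ++ prDiagrams ts (suc (suc o))) ++ (pr , o + 0) ∷ []
    ≡⟨ trans (cong (λ k → (prDiagram a o ++ prDiagram b (suc o) ++ prDiagrams ts (suc (suc o))) ++ (pr , k) ∷ []) (+-identityʳ o))
         (trans (++-assoc (prDiagram a o) _ _) (cong (prDiagram a o ++_) (++-assoc (prDiagram b (suc o)) _ _))) ⟩
  prDiagram a o ++ prDiagram b (suc o) ++ prDiagrams ts (suc (suc o)) ++ (pr , o) ∷ []
    ≈⟨ ≅-congˡ (prDiagram a o) (≅-congˡ (prDiagram b (suc o))
         (pr-slide-up o (prDiagrams ts (suc o)) (RightOf-prDiagrams ts o (suc o) ≤-refl)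
           ◅◅ ≅-reflexive (cong (_++ (pr , o) ∷ []) (shift-prDiagrams ts (suc o))))) ⟨
  prDiagram a o ++ prDiagram b (suc o) ++ (pr , o) ∷ prDiagrams ts (suc o)
    ≡⟨ trans (++-assoc (prDiagram a o) _ _) (cong (prDiagram a o ++_) (++-assoc (prDiagram b (suc o)) _ _)) ⟨
  (prDiagram a o ++ prDiagram b (suc o) ++ (pr , o) ∷ []) ++ prDiagrams ts (suc o) ∎
  where open ≅-Reasoning
prDiagrams-combine (t ∷ ts) o (suc i) (s≤s lt) = begin
  (prDiagram t o ++ prDiagrams ts (suc o)) ++ (pr , o + suc i) ∷ []
    ≡⟨ trans (++-assoc (prDiagram t o) _ _) (cong (λ k → prDiagram t o ++ prDiagrams ts (suc o) ++ (pr , k) ∷ []) (+-suc o i)) ⟩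
  prDiagram t o ++ (prDiagrams ts (suc o) ++ (pr , suc o + i) ∷ []) ≈⟨ ≅-congˡ (prDiagram t o) (prDiagrams-combine ts (suc o) i lt) ⟩
  prDiagram t o ++ prDiagrams (combine node i ts) (suc o)           ∎
  where open ≅-Reasoning

prDiagrams-leaves : ∀ m o → prDiagrams (leaves m) o ≡ []
prDiagrams-leaves zero    o = refl
prDiagrams-leaves (suc m) o = prDiagrams-leaves m (suc o)

ProductNormal : ℕ → Diagram → Set
ProductNormal m X = X ≅ prDiagrams (evalUp X (leaves m)) 0

products-normal-++ : ∀ Q P m v → OnlyOf pr P → Spans m (Q ++ P) v → ProductNormal m Q → ProductNormal m (Q ++ P)
products-normal-++ Q []             m v _          _ nf = subst (ProductNormal m) (sym (++-identityʳ Q)) nf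
products-normal-++ Q ((pr , i) ∷ P) m v (_ ∷ only) h nf =
  subst (ProductNormal m) (++-assoc Q ((pr , i) ∷ []) P)
    (products-normal-++ (Q ++ (pr , i) ∷ []) P m v only (subst (λ X → Spans m X v) (sym (++-assoc Q ((pr , i) ∷ []) P)) h) nf')
  where
    split = Spans-++⁻ m Q ((pr , i) ∷ P) v h
    ts = evalUp Q (leaves m)
    length-ts : length ts ≡ proj₁ split
    length-ts = length-evalUp m Q (proj₁ split) (leaves m) (proj₁ (proj₂ split)) (length-replicate m)
    nf' : ProductNormal m (Q ++ (pr , i) ∷ [])
    nf' = ≅-congʳ ((pr , i) ∷ []) nf
      ◅◅ (prDiagrams-combine ts 0 i (subst (suc i <_) (sym length-ts) (proj₁ (proj₂ (proj₂ split))))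
      ◅◅ ≅-reflexive (cong (λ X → prDiagrams X 0) (sym (evalUp-++ Q ((pr , i) ∷ []) (leaves m)))))

products-normal : ∀ P m v → OnlyOf pr P → Spans m P v → ProductNormal m P
products-normal P m v only h = products-normal-++ [] P m v only h (≅-reflexive (sym (prDiagrams-leaves m 0)))

length-evalUp-valid : ∀ D → Valid 1 D → length (evalUp D (leaf ∷ [])) ≡ 1
length-evalUp-valid D v = length-evalUp 1 D 1 (leaf ∷ []) (Valid→Spans 1 D v) refl

evalDown-Q : ∀ D → Valid 1 D → NoPC (false ∷ []) D → evalDown D (leaf ∷ []) ≡ coproductTree D ∷ []
evalDown-Q D v np = singleton _ (length-evalDown D 1 (false ∷ []) v np refl)

evalUp-after-coDiagram : ∀ c P → evalUp ((coDiagram c 0 ++ []) ++ P) (leaf ∷ []) ≡ evalUp P (leaves (suc (size c)))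
evalUp-after-coDiagram c P = trans (evalUp-++ (coDiagram c 0 ++ []) P (leaf ∷ [])) (cong (evalUp P) (trans
  (evalUp-coproducts (coDiagram c 0 ++ []) 1 (suc (size c + 0)) (++⁺ (OnlyOf-coDiagram c 0) [])
    (Spans-++⁺ 1 (coDiagram c 0) [] (suc (size c)) _ (Spans-coDiagram c 0 1 (s≤s z≤n)) (cong suc (sym (+-identityʳ _)))))
  (cong (λ k → leaves (suc k)) (+-identityʳ (size c)))))

normal-form : ∀ D → Valid 1 D → NoPC (false ∷ []) D → D ≅ canonical (coproductTree D) (productTree D)
normal-form D v np = begin
  D                          ≈⟨ iso ⟩
  (coDiagram c 0 ++ []) ++ P ≈⟨ ≅-congˡ (coDiagram c 0 ++ []) (products-normal P m 1 only (Valid→Spans m P valid)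
                                 ◅◅ ≅-reflexive (cong (λ l → prDiagrams l 0) products-eval)) ⟩
  (coDiagram c 0 ++ []) ++ (prDiagram (productTree D) 0 ++ [])
    ≡⟨ cong₂ _++_ (++-identityʳ (coDiagram c 0)) (++-identityʳ (prDiagram (productTree D) 0)) ⟩
  canonical c (productTree D) ∎
  where
    open ≅-Reasoning
    sorted = coproducts-first D 1 (false ∷ []) v np refl
    P = proj₁ sorted
    only = proj₁ (proj₂ sorted)
    c = coproductTree D
    m = suc (size c)
    iso : D ≅ ((coDiagram c 0 ++ []) ++ P)
    iso = subst (λ l → D ≅ (coDiagrams l 0 ++ P)) (evalDown-Q D v np) (proj₂ (proj₂ (proj₂ sorted)))
    valid : Valid m P
    valid = subst (λ k → Valid (suc k) P) (+-identityʳ (size c))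
              (subst (λ l → Valid (1 + totalSize l) P) (evalDown-Q D v np) (proj₁ (proj₂ (proj₂ sorted))))
    products-eval : evalUp P (leaves m) ≡ productTree D ∷ []
    products-eval = trans (singleton _ (length-evalUp m P 1 (leaves m) (Valid→Spans m P valid) (length-replicate m)))
      (cong (λ l → headTree l ∷ []) (sym (trans (≅-evalUp iso (leaf ∷ [])) (evalUp-after-coDiagram c P))))

infix 4 _⇝_
_⇝_ : Diagram → Diagram → Set
X ⇝ Y = ∃₂ λ A B → (X ≅ A) × (A ⟶ B) × (B ≅ Y)

⇝-cong : ∀ L R {X Y} → X ⇝ Y → (L ++ X ++ R) ⇝ (L ++ Y ++ R)
⇝-cong L R (A , B , i₁ , r , i₂) = L ++ A ++ R , L ++ B ++ R , ≅-cong L R i₁ , ⟶-cong L R r , ≅-cong L R i₂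

⇝-congˡ : ∀ L {X Y} → X ⇝ Y → (L ++ X) ⇝ (L ++ Y)
⇝-congˡ L {X} {Y} p = subst₂ _⇝_ (cong (L ++_) (++-identityʳ X)) (cong (L ++_) (++-identityʳ Y)) (⇝-cong L [] p)

⇝-congʳ : ∀ R {X Y} → X ⇝ Y → (X ++ R) ⇝ (Y ++ R)
⇝-congʳ R = ⇝-cong [] R

TStep-coDiagram : ∀ {c c'} → TStep c c' → ∀ o → coDiagram c o ⇝ coDiagram c' o
TStep-coDiagram (rot x y z) o =
  (co , o) ∷ (co , suc o) ∷ coDiagram z o ++ R , (co , o) ∷ (co , o) ∷ coDiagram z o ++ R ,
  ≅-∷ (co , o) slide , rot-co [] (coDiagram z o ++ R) o , ≅-reflexive rotated
  where
    o₂ = o + suc (size z)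
    R = coDiagram y o₂ ++ coDiagram x (o₂ + suc (size y))
    slide : (coDiagram z o ++ (co , o₂) ∷ R) ≅ ((co , suc o) ∷ coDiagram z o ++ R)
    slide = begin
      coDiagram z o ++ (co , o₂) ∷ R
        ≡⟨ trans (cong (λ k → coDiagram z o ++ (co , k) ∷ R) (+-suc o (size z))) (sym (++-assoc (coDiagram z o) _ R)) ⟩
      (coDiagram z o ++ (co , suc o + size z) ∷ []) ++ R ≈⟨ ≅-congʳ R (slide-up-coDiagram z o (suc o) co ≤-refl) ⟨
      (co , suc o) ∷ coDiagram z o ++ R                ∎
      where open ≅-Reasoning
    offset : ∀ o z y → o + suc z + suc y ≡ o + suc (suc (y + z))
    offset = solve-∀
    rotated : (co , o) ∷ (co , o) ∷ coDiagram z o ++ R ≡ coDiagram (node x (node y z)) o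
    rotated = cong (λ l → (co , o) ∷ (co , o) ∷ l)
      (trans (cong (λ k → coDiagram z o ++ coDiagram y o₂ ++ coDiagram x k) (offset o (size z) (size y)))
             (sym (++-assoc (coDiagram z o) _ _)))
TStep-coDiagram (congˡ t p) o = ⇝-congˡ ((co , o) ∷ coDiagram t o) (TStep-coDiagram p (o + suc (size t)))
TStep-coDiagram (congʳ s {t} {t'} p) o =
  subst ((co , o) ∷ coDiagram t o ++ coDiagram s (o + suc (size t)) ⇝_)
        (cong (λ k → (co , o) ∷ coDiagram t' o ++ coDiagram s (o + suc k)) (TStep-size p))
        (⇝-cong ((co , o) ∷ []) (coDiagram s (o + suc (size t))) (TStep-coDiagram p o))

TStep-prDiagram : ∀ {p p'} → TStep p p' → ∀ o → prDiagram p o ⇝ prDiagram p' o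
TStep-prDiagram (rot x y z) o =
  (X ++ Y ++ Z) ++ (pr , o) ∷ (pr , o) ∷ [] , (X ++ Y ++ Z) ++ (pr , suc o) ∷ (pr , o) ∷ [] ,
  slide , rot-pr (X ++ Y ++ Z) [] o , ≅-reflexive rotated
  where
    X = prDiagram x o
    Y = prDiagram y (suc o)
    Z = prDiagram z (suc (suc o))
    reassoc : ∀ {tail} → (X ++ Y ++ Z) ++ tail ≡ X ++ Y ++ Z ++ tail
    reassoc = trans (++-assoc X _ _) (cong (X ++_) (++-assoc Y _ _))
    slide : prDiagram (node (node x y) z) o ≅ ((X ++ Y ++ Z) ++ (pr , o) ∷ (pr , o) ∷ [])
    slide = begin
      (X ++ Y ++ (pr , o) ∷ []) ++ prDiagram z (suc o) ++ (pr , o) ∷ []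
        ≡⟨ trans (++-assoc X _ _) (cong (X ++_) (++-assoc Y _ _)) ⟩
      X ++ Y ++ ((pr , o) ∷ prDiagram z (suc o)) ++ (pr , o) ∷ []
        ≈⟨ ≅-congˡ X (≅-congˡ Y (≅-congʳ ((pr , o) ∷ []) (pr-slide-up-prDiagram z o))) ⟩
      X ++ Y ++ (Z ++ (pr , o) ∷ []) ++ (pr , o) ∷ []  ≡⟨ cong (λ l → X ++ Y ++ l) (++-assoc Z _ _) ⟩
      X ++ Y ++ Z ++ (pr , o) ∷ (pr , o) ∷ []          ≡⟨ reassoc ⟨
      (X ++ Y ++ Z) ++ (pr , o) ∷ (pr , o) ∷ []        ∎
      where open ≅-Reasoning
    rotated : (X ++ Y ++ Z) ++ (pr , suc o) ∷ (pr , o) ∷ [] ≡ prDiagram (node x (node y z)) o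
    rotated = trans reassoc (cong (X ++_) (trans (cong (Y ++_) (sym (++-assoc Z _ _))) (sym (++-assoc Y _ _))))
TStep-prDiagram (congˡ t p) o = ⇝-congʳ (prDiagram t (suc o) ++ (pr , o) ∷ []) (TStep-prDiagram p o)
TStep-prDiagram (congʳ s p) o = ⇝-cong (prDiagram s o) ((pr , o) ∷ []) (TStep-prDiagram p (suc o))

module _ {n : ℕ} where

  coproductTree-size : (P : Q n) → size (coproductTree (proj₁ P)) ≡ n
  coproductTree-size (D , v , #co≡n , _ , np) =
    trans (sym (totalSize-singleton (evalDown D (leaf ∷ [])) (length-evalDown D 1 (false ∷ []) v np refl)))
          (trans (totalSize-evalDown D 1 (false ∷ []) v np refl) #co≡n)

  productTree-size : (P : Q n) → size (productTree (proj₁ P)) ≡ n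
  productTree-size (D , v , _ , #pr≡n , _) =
    trans (sym (totalSize-singleton (evalUp D (leaf ∷ [])) (length-evalUp-valid D v)))
          (trans (totalSize-evalUp D 1 (leaf ∷ []) (Valid→Spans 1 D v) refl) #pr≡n)

  trees : Q n → T n × T n
  trees P = (coproductTree (proj₁ P) , coproductTree-size P) , (productTree (proj₁ P) , productTree-size P)

  fromTrees : T n × T n → Q n
  fromTrees ((c , ec) , (p , ep)) = canonical c p , canonical-IsQ n c p ec ep

  trees-fromTrees : (x : T n × T n) → trees (fromTrees x) ≡ x
  trees-fromTrees ((c , ec) , (p , ep)) =
    cong₂ _,_ (T-≡ (coproductTree-canonical c p (trans ec (sym ep)))) (T-≡ (productTree-canonical c p (trans ec (sym ep))))

  ≈Q-fromTrees : (P : Q n) → P ≈Q fromTrees (trees P)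
  ≈Q-fromTrees (D , v , _ , _ , np) = normal-form D v np

  trees-resp-≈Q : (P R : Q n) → P ≈Q R → trees P ≡ trees R
  trees-resp-≈Q P R iso = cong₂ _,_ (T-≡ (≅-coproductTree iso)) (T-≡ (≅-productTree iso))

  trees-injective : (P R : Q n) → trees P ≡ trees R → P ≈Q R
  trees-injective P R e = ≈Q-fromTrees P ◅◅ (≅-reflexive (cong (λ x → proj₁ (fromTrees x)) e) ◅◅ ≅-sym (≈Q-fromTrees R))

  ⇝-trees : ∀ {P R : Q n} → proj₁ P ⇝ proj₁ R → trees P ≤TT trees R
  ⇝-trees (A , B , i₁ , r , i₂) =
    ≤ₜ-reflexive (≅-coproductTree i₁) ◅◅ ⟶-coproductTree r ◅◅ ≤ₜ-reflexive (≅-coproductTree i₂) ,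
    ≤ₜ-reflexive (≅-productTree i₁) ◅◅ ⟶-productTree r ◅◅ ≤ₜ-reflexive (≅-productTree i₂)

  step-trees : {P R : Q n} → (P ≈Q R) ⊎ RotQ P R → trees P ≤TT trees R
  step-trees (inj₁ iso) = ≤ₜ-reflexive (≅-coproductTree iso) , ≤ₜ-reflexive (≅-productTree iso)
  step-trees {P} {R} (inj₂ rotation) = ⇝-trees {P} {R} rotation

  ≤TT-trans : ∀ {x y z : T n × T n} → x ≤TT y → y ≤TT z → x ≤TT z
  ≤TT-trans (a , b) (c , d) = a ◅◅ c , b ◅◅ d

  trees-mono : {P R : Q n} → P ≤Q R → trees P ≤TT trees R
  trees-mono ε = ε , ε
  trees-mono {P} {R} (_◅_ {j = M} s steps) = ≤TT-trans {trees P} {trees M} {trees R} (step-trees {P} {M} s) (trees-mono steps)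

  fromTrees-monoˡ : ∀ {c c'} → c ≤ₜ c' → ∀ p (ec : size c ≡ n) (ec' : size c' ≡ n) (ep : size p ≡ n) →
                    fromTrees ((c , ec) , (p , ep)) ≤Q fromTrees ((c' , ec') , (p , ep))
  fromTrees-monoˡ ε        p ec ec' ep = inj₁ ε ◅ ε
  fromTrees-monoˡ (s ◅ ss) p ec ec' ep =
    inj₂ (⇝-congʳ (prDiagram p 0) (TStep-coDiagram s 0)) ◅ fromTrees-monoˡ ss p (trans (sym (TStep-size s)) ec) ec' ep

  fromTrees-monoʳ : ∀ {p p'} → p ≤ₜ p' → ∀ c (ec : size c ≡ n) (ep : size p ≡ n) (ep' : size p' ≡ n) →
                    fromTrees ((c , ec) , (p , ep)) ≤Q fromTrees ((c , ec) , (p' , ep'))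
  fromTrees-monoʳ ε        c ec ep ep' = inj₁ ε ◅ ε
  fromTrees-monoʳ (s ◅ ss) c ec ep ep' =
    inj₂ (⇝-congˡ (coDiagram c 0) (TStep-prDiagram s 0)) ◅ fromTrees-monoʳ ss c ec (trans (sym (TStep-size s)) ep) ep'

  fromTrees-mono : (x y : T n × T n) → x ≤TT y → fromTrees x ≤Q fromTrees y
  fromTrees-mono ((c , ec) , (p , ep)) ((c' , ec') , (p' , ep')) (c≤c' , p≤p') =
    fromTrees-monoˡ c≤c' p ec ec' ep ◅◅ fromTrees-monoʳ p≤p' c' ec' ep ep'

  trees-reflect : (P R : Q n) → trees P ≤TT trees R → P ≤Q R
  trees-reflect P R le =
    (inj₁ (≈Q-fromTrees P) ◅ ε) ◅◅ fromTrees-mono (trees P) (trees R) le ◅◅ (inj₁ (≅-sym (≈Q-fromTrees R)) ◅ ε)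

module _ {n : ℕ} where

  _∨TT_ _∧TT_ : T n × T n → T n × T n → T n × T n
  (s₁ , s₂) ∨TT (t₁ , t₂) = joinT s₁ t₁ , joinT s₂ t₂
  (s₁ , s₂) ∧TT (t₁ , t₂) = meetT s₁ t₁ , meetT s₂ t₂

  _∨Q_ _∧Q_ : Q n → Q n → Q n
  P ∨Q R = fromTrees (trees P ∨TT trees R)
  P ∧Q R = fromTrees (trees P ∧TT trees R)

  ≤Q-fromTrees : (P : Q n) (x : T n × T n) → trees P ≤TT x → P ≤Q fromTrees x
  ≤Q-fromTrees P x le = trees-reflect P (fromTrees x) (subst (trees P ≤TT_) (sym (trees-fromTrees x)) le)

  fromTrees-≤Q : (x : T n × T n) (P : Q n) → x ≤TT trees P → fromTrees x ≤Q P
  fromTrees-≤Q x P le = trees-reflect (fromTrees x) P (subst (_≤TT trees P) (sym (trees-fromTrees x)) le)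

  Q-isLattice : IsLattice (_≈Q_ {n}) (_≤Q_ {n}) _∨Q_ _∧Q_
  Q-isLattice = record
    { isPartialOrder = record
      { isPreorder = record
        { isEquivalence = record { refl = ε ; sym = ≅-sym ; trans = _◅◅_ }
        ; reflexive     = λ iso → inj₁ iso ◅ ε
        ; trans         = _◅◅_
        }
      ; antisym = λ {P} {R} p q → trees-injective P R (≤TT-antisym (trees-mono p) (trees-mono q))
      }
    ; supremum = λ P R →
        ≤Q-fromTrees P (trees P ∨TT trees R) (joinT-≥ˡ (cT P) (cT R) , joinT-≥ˡ (pT P) (pT R)) ,
        ≤Q-fromTrees R (trees P ∨TT trees R) (joinT-≥ʳ (cT P) (cT R) , joinT-≥ʳ (pT P) (pT R)) ,
        λ Z p q → let (p₁ , p₂) = trees-mono p ; (q₁ , q₂) = trees-mono q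
                  in fromTrees-≤Q (trees P ∨TT trees R) Z (joinT-least (cT P) (cT R) (cT Z) p₁ q₁ , joinT-least (pT P) (pT R) (pT Z) p₂ q₂)
    ; infimum = λ P R →
        fromTrees-≤Q (trees P ∧TT trees R) P (meetT-≤ˡ (cT P) (cT R) , meetT-≤ˡ (pT P) (pT R)) ,
        fromTrees-≤Q (trees P ∧TT trees R) R (meetT-≤ʳ (cT P) (cT R) , meetT-≤ʳ (pT P) (pT R)) ,
        λ Z p q → let (p₁ , p₂) = trees-mono p ; (q₁ , q₂) = trees-mono q
                  in ≤Q-fromTrees Z (trees P ∧TT trees R) (meetT-greatest (cT P) (cT R) (cT Z) p₁ q₁ , meetT-greatest (pT P) (pT R) (pT Z) p₂ q₂)
    }
    where
      cT pT : Q n → T n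
      cT P = proj₁ (trees P)
      pT P = proj₂ (trees P)
      ≤TT-antisym : ∀ {x y : T n × T n} → x ≤TT y → y ≤TT x → x ≡ y
      ≤TT-antisym (a , b) (c , d) = cong₂ _,_ (T-≡ (≤ₜ-antisym a c)) (T-≡ (≤ₜ-antisym b d))

mainTheorem2 : (n : ℕ) → 1 ≤ n →
    (Σ (Q n → Q n → Q n) λ _∨_ → Σ (Q n → Q n → Q n) λ _∧_ →
       IsLattice (_≈Q_ {n}) (_≤Q_ {n}) _∨_ _∧_)
    × Σ (Q n → T n × T n) (λ φ →
         (∀ P R → P ≈Q R → φ P ≡ φ R)
       × (∀ P R → φ P ≡ φ R → P ≈Q R)
       × (∀ t → ∃ λ P → φ P ≡ t)
       × (∀ P R → (P ≤Q R) ⇔ (φ P ≤TT φ R)))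
mainTheorem2 n _ =
  (_∨Q_ , _∧Q_ , Q-isLattice) ,
  trees , trees-resp-≈Q , trees-injective , (λ x → fromTrees x , trees-fromTrees x) ,
  λ P R → mk⇔ trees-mono (trees-reflect P R)
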